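{- Let $p>5$ be prime and let $\mathbf{x}=(x_1,x_2,x_3)\in\mathcal{X}^*(p)$ be such that for some $i\in\{1,2,3\}$ the coordinate $x_i$ is elliptic and $\left(\frac{3x_i+2}{p}\right)=-1$. If \[\nu_2(p+1)>\log_2\!\left(\frac{p+1}{2}\right),\] then $\mathbf{x}\in\mathcal{C}(p)$.
   Context: $\mathcal{X}^*(p)$ denotes the set of nonzero solutions $(x_1,x_2,x_3)\in\mathbb{F}_p^3\setminus\{(0,0,0)\}$ of $x_1^2+x_2^2+x_3^2=3x_1x_2x_3$. Rotations: $\mathrm{rot}_1(x_1,x_2,x_3)=(x_1,x_3,3x_1x_3-x_2)$, $\mathrm{rot}_2(x_1,x_2,x_3)=(x_3,x_2,3x_2x_3-x_1)$, $\mathrm{rot}_3(x_1,x_2,x_3)=(x_2,3x_2x_3-x_1,x_3)$; $\mathrm{ord}_{p,i}(\mathbf{x})=\min\{n\in\mathbb{Z}_{>0}:\mathrm{rot}_i^n(\mathbf{x})=\mathbf{x}\}$ (equivalently the order of $\begin{pmatrix}0&1\\-1&3x_i\end{pmatrix}$ in $\mathrm{GL}_2(\mathbb{F}_p)$). For $x\in\mathbb{F}_p$, $x$ is elliptic if $9x^2-4$ is not a square mod $p$. $\nu_2$ is the $2$-adic valuation and $\left(\frac{\cdot}{p}\right)$ the Legendre symbol. A point $\mathbf{x}\in\mathcal{X}^*(p)$ is maximal if $\mathrm{ord}_{p,i}(\mathbf{x})\in\{p-1,p+1,2p\}$ for some $i$; the cage $\mathcal{C}(p)$ is the set (subgraph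 of the graph on $\mathcal{X}^*(p)$ with edges $(\mathbf{x},\mathrm{rot}_i\mathbf{x})$) of all maximal points. -}

module Defs where

open import Data.Nat using (ℕ; zero; suc; _+_; _*_; _∸_; _^_; _<_; NonZero; _≡ᵇ_)
open import Data.Nat.DivMod using (_%_; _/_)
open import Data.Bool using (Bool; true; false; if_then_else_)
open import Data.Fin using (Fin; zero; suc)
open import Data.Product using (_×_; _,_; ∃; ∃-syntax)
open import Data.Sum using (_⊎_)
open import Relation.Binary.PropositionalEquality using (_≡_; _≢_)
open import Relation.Nullary using (¬_)

-- Elements of 𝔽_p are represented by natural numbers < p; all arithmetic is mod p.
Triple : Set
Triple = ℕ × ℕ × ℕ

module _ (p : ℕ) .{{_ : NonZero p}} where

  subP : ℕ → ℕ → ℕ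
  subP a b = (a + (p ∸ (b % p))) % p

  InFp3 : Triple → Set
  InFp3 (x₁ , x₂ , x₃) = (x₁ < p) × (x₂ < p) × (x₃ < p)

  InXstar : Triple → Set
  InXstar x@(x₁ , x₂ , x₃) =
    InFp3 x × ¬ (x ≡ (0 , 0 , 0)) ×
    ((x₁ * x₁ + x₂ * x₂ + x₃ * x₃) % p ≡ (3 * x₁ * x₂ * x₃) % p)

  rot : Fin 3 → Triple → Triple
  rot zero (x₁ , x₂ , x₃) = (x₁ , x₃ , subP (3 * x₁ * x₃) x₂)
  rot (suc zero) (x₁ , x₂ , x₃) = (x₃ , x₂ , subP (3 * x₂ * x₃) x₁)
  rot (suc (suc zero)) (x₁ , x₂ , x₃) = (x₂ , subP (3 * x₂ * x₃) x₁ , x₃)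

  rotIter : Fin 3 → ℕ → Triple → Triple
  rotIter i zero x = x
  rotIter i (suc n) x = rot i (rotIter i n x)

  IsOrd : Fin 3 → Triple → ℕ → Set
  IsOrd i x n = (0 < n) × (rotIter i n x ≡ x) ×
                (∀ m → 0 < m → m < n → rotIter i m x ≢ x)

  Maximal : Triple → Set
  Maximal x = ∃[ i ] ∃[ n ] (IsOrd i x n × (n ≡ p ∸ 1 ⊎ n ≡ p + 1 ⊎ n ≡ 2 * p))

  InCage : Triple → Set
  InCage x = InXstar x × Maximal x

  IsSquareModP : ℕ → Set
  IsSquareModP a = ∃[ y ] (y < p × (y * y) % p ≡ a % p)

  Elliptic : ℕ → Set
  Elliptic x = ¬ IsSquareModP (subP (9 * x * x) 4)

  LegendreMinusOne : ℕ → Set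
  LegendreMinusOne a = ¬ (a % p ≡ 0) × ¬ IsSquareModP a

coord : Fin 3 → Triple → ℕ
coord zero (x₁ , _ , _) = x₁
coord (suc zero) (_ , x₂ , _) = x₂
coord (suc (suc zero)) (_ , _ , x₃) = x₃

-- 2-adic valuation ν₂(n) (with ν₂(0) = 0 by convention; only used for n > 0),
-- computed with fuel n, which suffices since ν₂(n) ≤ n.
ν₂-aux : ℕ → ℕ → ℕ
ν₂-aux zero n = 0
ν₂-aux (suc f) zero = 0
ν₂-aux (suc f) n@(suc _) = if (n % 2) ≡ᵇ 0 then suc (ν₂-aux f (n / 2)) else 0

ν₂ : ℕ → ℕ
ν₂ n = ν₂-aux n n

-- Let c = x_i and a = 3c. On the two other coordinates rot_i is the linear recurrence
-- (y, z) ↦ (z, az − y), with characteristic polynomial X² − aX + 1 of discriminant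
-- D = 9c² − 4. As c is elliptic, D is a non-square, so in 𝔽_p[√D] the roots are
-- t = (a + √D)/2 and t̄ = t^p (Frobenius), and (y, z) ↦ z − y·t̄ turns rot_i into
-- multiplication by t. Put w = t + 1 and e = (p − 1)/2. Then w·w^p = w·(t̄ + 1) = a + 2,
-- and also w·w^p = w²·(w²)^e = −(a + 2)·t^(1+e), because w² = (a + 2)·t and
-- (a + 2)^e = −1 by Euler's criterion (3c + 2 is a non-residue). Hence t^((p+1)/2) = −1.
-- The ν₂ hypothesis says that p + 1 = 2^(j+1), so t, and with it every nonzero point
-- under rot_i, has order exactly p + 1.

{-# OPTIONS --safe #-}
module Submission where

open import Defs
open import Algebra.Bundles using (AbelianGroup; CommutativeMonoid; CommutativeSemiring; CommutativeRing)
open import Algebra.Definitions using (Congruent₂)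
open import Data.Bool using (Bool; true; false; if_then_else_; _∧_; not)
open import Data.Bool.Properties using (∧-identityʳ; ∧-zeroʳ; if-cong)
open import Data.Empty using (⊥-elim)
open import Data.Fin as Fin using (Fin; toℕ; fromℕ)
open import Data.Fin.Properties using (toℕ-inject₁; toℕ-fromℕ; toℕ<n)
import Data.Nat as ℕ
open ℕ using (ℕ; zero; suc; NonZero; nonTrivial⇒≢1)
import Data.Nat.Properties as ℕₚ
open import Data.Nat.Combinatorics using (_C_; nCn≡1; k![n∸k]!∣n!)
open import Data.Nat.Combinatorics.Specification using (nCk≡n!/k![n-k]!)
open import Data.Nat.Divisibility using (_∣_; divides; ∣1⇒≡1; ∣⇒≤; m∣m*n)
open import Data.Nat.GeneralisedArithmetic using (fold)
open import Data.Nat.Primality using (Prime; prime⇒nonZero; prime⇒nonTrivial; euclidsLemma)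
open import Data.Product using (_×_; _,_; proj₁; proj₂; ∃-syntax)
open import Data.Sum using (_⊎_; inj₁; inj₂; [_,_]′)
open import Function using (id; const; _∘_)
open import Level using (0ℓ)
open import Relation.Binary.Core using (Rel)
import Relation.Binary.Construct.On as On
open import Relation.Binary.PropositionalEquality as ≡ using (_≡_; _≢_; cong; cong₂; subst)
open import Relation.Nullary using (¬_; Dec; contradiction)
open import Relation.Nullary.Decidable using (⌊_⌋; yes; no)

module _ where
  open import Data.Nat using (_*_; _∸_; _<_; _!)
  open import Data.Nat.DivMod using (_/_; m/n*n≡m)
  open import Data.Nat.Properties

  prime∤! : ∀ {p} → Prime p → ∀ m → m < p → ¬ (p ∣ m !)
  prime∤! {p} p-prime zero _ p∣1 = nonTrivial⇒≢1 (∣1⇒≡1 p∣1)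
    where instance _ = prime⇒nonTrivial p-prime
  prime∤! p-prime (suc m) m<p p∣m! with euclidsLemma (suc m) (m !) p-prime p∣m!
  ... | inj₁ p∣1+m = <⇒≱ m<p (∣⇒≤ p∣1+m)
  ... | inj₂ p∣m!  = prime∤! p-prime m (<-trans (n<1+n m) m<p) p∣m!

  prime∣binomial : ∀ {p} → Prime p → ∀ {k} → 0 < k → k < p → p ∣ p C k
  prime∣binomial {p} p-prime {k} 0<k k<p
    with euclidsLemma (p C k) (k ! * (p ∸ k) !) p-prime p∣C*k![p∸k]!
    where
    instance _ = prime⇒nonZero p-prime
    instance _ = k !* (p ∸ k) !≢0
    p∣C*k![p∸k]! : p ∣ (p C k) * (k ! * (p ∸ k) !)
    p∣C*k![p∸k]! = subst (p ∣_) (≡.sym (begin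
      (p C k) * (k ! * (p ∸ k) !)                 ≡⟨ cong (_* (k ! * (p ∸ k) !)) (nCk≡n!/k![n-k]! (<⇒≤ k<p)) ⟩
      p ! / (k ! * (p ∸ k) !) * (k ! * (p ∸ k) !) ≡⟨ m/n*n≡m (k![n∸k]!∣n! (<⇒≤ k<p)) ⟩
      p !                                          ∎))
      (subst (λ n → n ∣ n !) (suc-pred p) (m∣m*n (ℕ.pred p !)))
      where open ≡.≡-Reasoning
  ... | inj₁ p∣C = p∣C
  ... | inj₂ p∣k!*[p∸k]! with euclidsLemma (k !) ((p ∸ k) !) p-prime p∣k!*[p∸k]!
  ...   | inj₁ p∣k!      = ⊥-elim (prime∤! p-prime k k<p p∣k!)
  ...   | inj₂ p∣[p∸k]!  = ⊥-elim (prime∤! p-prime (p ∸ k) (∸-monoʳ-< 0<k (<⇒≤ k<p)) p∣[p∸k]!)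

  data Parity : ℕ → Set where
    even : ∀ k → Parity (2 * k)
    odd  : ∀ k → Parity (suc (2 * k))

  parity : ∀ n → Parity n
  parity zero    = even 0
  parity (suc n) with parity n
  ... | even k = odd k
  ... | odd k  = subst Parity (cong suc (+-suc k (k ℕ.+ 0))) (even (suc k))

  1+2e-prime⇒e≢0 : ∀ {p e} → Prime p → p ≡ suc (2 * e) → e ≢ 0
  1+2e-prime⇒e≢0 p-prime p≡1+2e e≡0 = nonTrivial⇒≢1 (≡.trans p≡1+2e (cong (λ k → suc (2 * k)) e≡0))
    where instance _ = prime⇒nonTrivial p-prime

-- The Frobenius map in characteristic p

module _ {c ℓ} (S : CommutativeSemiring c ℓ) where
  open CommutativeSemiring S hiding (zero)
  open import Algebra.Properties.Semiring.Exp semiring using (_^_; ^-congʳ)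
  open import Algebra.Properties.Semiring.Mult semiring
    using (×-cong; ×-congˡ; ×-congʳ; ×-assocˡ; ×-assoc-*) renaming (_×_ to _·_)
  open import Algebra.Properties.Monoid.Sum +-monoid
    using (sum; sum-cong-≋; sum-init-last; sum-replicate-zero)
  open import Algebra.Properties.CommutativeSemiring.Binomial S
    using (binomialTerm; theorem)
  open import Data.Vec.Functional using (init; tail; last)
  open import Relation.Binary.Reasoning.Setoid setoid

  [x+y]^p≈x^p+y^p : ∀ {p} → Prime p → p · 1# ≈ 0# → ∀ x y → (x + y) ^ p ≈ x ^ p + y ^ p
  [x+y]^p≈x^p+y^p {p@(suc m)} p-prime p·1≈0 x y = begin
    (x + y) ^ p                                         ≈⟨ theorem p x y ⟩
    T Fin.zero + sum (tail T)                           ≈⟨ +-congˡ (sum-init-last (tail T)) ⟩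
    T Fin.zero + (sum (init (tail T)) + last (tail T))  ≈⟨ +-cong first-term (+-cong middle-terms last-term) ⟩
    y ^ p + (0# + x ^ p)                                ≈⟨ +-congˡ (+-identityˡ (x ^ p)) ⟩
    y ^ p + x ^ p                                       ≈⟨ +-comm (y ^ p) (x ^ p) ⟩
    x ^ p + y ^ p                                       ∎
    where
    T = binomialTerm x y p
    p·≈0 : ∀ z → p · z ≈ 0#
    p·≈0 z = begin
      p · z          ≈⟨ ×-congʳ p (*-identityˡ z) ⟨
      p · (1# * z)   ≈⟨ ×-assoc-* p 1# z ⟨
      (p · 1#) * z   ≈⟨ *-congʳ p·1≈0 ⟩
      0# * z         ≈⟨ zeroˡ z ⟩
      0#             ∎
    pCk·z≈0 : ∀ {k} z → 0 ℕ.< k → k ℕ.< p → (p C k) · z ≈ 0#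
    pCk·z≈0 {k} z 0<k k<p with prime∣binomial p-prime 0<k k<p
    ... | divides q C≡q*p = begin
      (p C k) · z      ≈⟨ ×-congˡ (≡.trans C≡q*p (ℕₚ.*-comm q p)) ⟩
      (p ℕ.* q) · z    ≈⟨ ×-assocˡ z p q ⟨
      p · (q · z)      ≈⟨ p·≈0 (q · z) ⟩
      0#               ∎
    first-term : T Fin.zero ≈ y ^ p
    first-term = trans (+-identityʳ _) (*-identityˡ _)
    middle-terms : sum (init (tail T)) ≈ 0#
    middle-terms = trans
      (sum-cong-≋ λ j → pCk·z≈0 _ (ℕ.s≤s ℕ.z≤n) (ℕ.s≤s (subst (ℕ._< m) (≡.sym (toℕ-inject₁ j)) (toℕ<n j))))
      (sum-replicate-zero m)
    last-term : last (tail T) ≈ x ^ p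
    last-term = begin
      term (suc (toℕ (fromℕ m)))          ≡⟨ cong (term ∘ suc) (toℕ-fromℕ m) ⟩
      (p C p) · (x ^ p * y ^ (p ℕ.∸ p))   ≈⟨ ×-cong (nCn≡1 p) (*-congˡ (^-congʳ y (ℕₚ.n∸n≡0 p))) ⟩
      1 · (x ^ p * 1#)                    ≈⟨ +-identityʳ _ ⟩
      x ^ p * 1#                          ≈⟨ *-identityʳ _ ⟩
      x ^ p                               ∎
      where
      term : ℕ → Carrier
      term k = (p C k) · (x ^ k * y ^ (p ℕ.∸ k))

module _ {c ℓ} (R : CommutativeRing c ℓ) where
  open CommutativeRing R hiding (zero)
  open import Algebra.Properties.Ring ring using (-1*x≈-x; -‿involutive; -‿distribʳ-*)
  open import Algebra.Properties.Semiring.Exp semiring using (_^_; ^-congˡ; ^-congʳ; ^-assocʳ)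
  open import Algebra.Properties.CommutativeSemiring.Exp commutativeSemiring using (^-distrib-*)
  open import Algebra.Properties.Semiring.Mult semiring using () renaming (_×_ to _·_)
  open import Relation.Binary.Reasoning.Setoid setoid

  1^n≈1 : ∀ n → 1# ^ n ≈ 1#
  1^n≈1 zero    = refl
  1^n≈1 (suc n) = trans (*-identityˡ _) (1^n≈1 n)

  -1*-1≈1 : - 1# * - 1# ≈ 1#
  -1*-1≈1 = trans (-1*x≈-x (- 1#)) (-‿involutive 1#)

  [-1]^[1+2k]≈-1 : ∀ k → (- 1#) ^ suc (2 ℕ.* k) ≈ - 1#
  [-1]^[1+2k]≈-1 k = begin
    - 1# * (- 1#) ^ (2 ℕ.* k)  ≈⟨ *-congˡ (^-assocʳ (- 1#) 2 k) ⟨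
    - 1# * ((- 1#) ^ 2) ^ k    ≈⟨ *-congˡ (^-congˡ k (*-congˡ (*-identityʳ (- 1#)))) ⟩
    - 1# * (- 1# * - 1#) ^ k   ≈⟨ *-congˡ (^-congˡ k -1*-1≈1) ⟩
    - 1# * 1# ^ k              ≈⟨ *-congˡ (1^n≈1 k) ⟩
    - 1# * 1#                  ≈⟨ *-identityʳ (- 1#) ⟩
    - 1#                       ∎

  ^2^j≈-1⇒^m≉1 : - 1# ≉ 1# → ∀ j {t} → t ^ (2 ℕ.^ j) ≈ - 1# →
                 ∀ {m} → 0 ℕ.< m → m ℕ.< 2 ℕ.^ suc j → ¬ (t ^ m ≈ 1#)
  ^2^j≈-1⇒^m≉1 -1≉1 j {t} t^2^j≈-1 {m} 0<m m<2^[1+j] t^m≈1 with parity m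
  ... | odd k = -1≉1 (begin
    - 1#                      ≈⟨ [-1]^[1+2k]≈-1 k ⟨
    (- 1#) ^ m                ≈⟨ ^-congˡ m t^2^j≈-1 ⟨
    (t ^ (2 ℕ.^ j)) ^ m       ≈⟨ ^-assocʳ t (2 ℕ.^ j) m ⟩
    t ^ (2 ℕ.^ j ℕ.* m)       ≡⟨ cong (t ^_) (ℕₚ.*-comm (2 ℕ.^ j) m) ⟩
    t ^ (m ℕ.* 2 ℕ.^ j)       ≈⟨ ^-assocʳ t m (2 ℕ.^ j) ⟨
    (t ^ m) ^ (2 ℕ.^ j)       ≈⟨ ^-congˡ (2 ℕ.^ j) t^m≈1 ⟩
    1# ^ (2 ℕ.^ j)            ≈⟨ 1^n≈1 (2 ℕ.^ j) ⟩
    1#                        ∎)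
  ^2^j≈-1⇒^m≉1 -1≉1 j       t^2^j≈-1 () m<2^[1+j] t^m≈1 | even zero
  ^2^j≈-1⇒^m≉1 -1≉1 zero    t^2^j≈-1 0<m m<2 t^m≈1 | even (suc k) =
    ℕₚ.<⇒≱ m<2 (ℕₚ.*-monoʳ-≤ 2 (ℕ.s≤s ℕ.z≤n))
  ^2^j≈-1⇒^m≉1 -1≉1 (suc j) {t} t^2^j≈-1 0<m m<2^[2+j] t^m≈1 | even (suc k) =
    ^2^j≈-1⇒^m≉1 -1≉1 j [t²]^2^j≈-1 (ℕ.s≤s ℕ.z≤n) (ℕₚ.*-cancelˡ-< 2 (suc k) (2 ℕ.^ suc j) m<2^[2+j])
      (trans (^-assocʳ t 2 (suc k)) t^m≈1)
    where
    [t²]^2^j≈-1 : (t ^ 2) ^ (2 ℕ.^ j) ≈ - 1#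
    [t²]^2^j≈-1 = trans (^-assocʳ t 2 (2 ℕ.^ j)) t^2^j≈-1

  ^2^j≈-1⇒^2^[1+j]≈1 : ∀ j {t} → t ^ (2 ℕ.^ j) ≈ - 1# → t ^ (2 ℕ.^ suc j) ≈ 1#
  ^2^j≈-1⇒^2^[1+j]≈1 j {t} t^2^j≈-1 = begin
    t ^ (2 ℕ.* 2 ℕ.^ j)       ≡⟨ cong (t ^_) (ℕₚ.*-comm 2 (2 ℕ.^ j)) ⟩
    t ^ (2 ℕ.^ j ℕ.* 2)       ≈⟨ ^-assocʳ t (2 ℕ.^ j) 2 ⟨
    (t ^ (2 ℕ.^ j)) ^ 2       ≈⟨ ^-congˡ 2 t^2^j≈-1 ⟩
    (- 1#) ^ 2                ≈⟨ *-congˡ (*-identityʳ (- 1#)) ⟩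
    - 1# * - 1#               ≈⟨ -1*-1≈1 ⟩
    1#                        ∎

  *-cancelʳ-unit : ∀ {x y u v} → u * v ≈ 1# → x * u ≈ y * u → x ≈ y
  *-cancelʳ-unit {x} {y} {u} {v} uv≈1 xu≈yu = begin
    x             ≈⟨ *-identityʳ x ⟨
    x * 1#        ≈⟨ *-congˡ uv≈1 ⟨
    x * (u * v)   ≈⟨ *-assoc x u v ⟨
    x * u * v     ≈⟨ *-congʳ xu≈yu ⟩
    y * u * v     ≈⟨ *-assoc y u v ⟩
    y * (u * v)   ≈⟨ *-congˡ uv≈1 ⟩
    y * 1#        ≈⟨ *-identityʳ y ⟩
    y             ∎

  -- t and t̄ are the two roots of X² − aX + 1.
  module ConjugateRoots {t t̄ a : Carrier} (tt̄≈1 : t * t̄ ≈ 1#) (t+t̄≈a : t + t̄ ≈ a) where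
    open import Algebra.Properties.Ring ring using (x[y-z]≈xy-xz)
    open import Algebra.Solver.Ring.NaturalCoefficients.Default commutativeSemiring

    t[z-yt̄]≈[az-y]-zt̄ : ∀ y z → t * (z - y * t̄) ≈ (a * z - y) - z * t̄
    t[z-yt̄]≈[az-y]-zt̄ y z = begin
      t * (z - y * t̄)
        ≈⟨ x[y-z]≈xy-xz t z (y * t̄) ⟩
      t * z - t * (y * t̄)
        ≈⟨ +-congˡ (-‿cong (trans (x∙yz≈y∙xz t y t̄) (trans (*-congˡ tt̄≈1) (*-identityʳ y)))) ⟩
      t * z - y
        ≈⟨ +-identityʳ _ ⟨
      (t * z - y) + 0#
        ≈⟨ +-congˡ (trans (+-congʳ (*-comm t̄ z)) (-‿inverseʳ (z * t̄))) ⟨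
      (t * z - y) + (t̄ * z - z * t̄)
        ≈⟨ solve 4 (λ tz y t̄z N → (tz :+ y) :+ (t̄z :+ N) := ((tz :+ t̄z) :+ y) :+ N)
                   refl (t * z) (- y) (t̄ * z) (- (z * t̄)) ⟩
      ((t * z + t̄ * z) - y) - z * t̄
        ≈⟨ +-congʳ (+-congʳ (trans (sym (distribʳ z t t̄)) (*-congʳ t+t̄≈a))) ⟩
      (a * z - y) - z * t̄ ∎
      where open import Algebra.Properties.CommutativeSemigroup *-commutativeSemigroup using (x∙yz≈y∙xz)

    module _ {p e} (p-prime : Prime p) (p·1≈0 : p · 1# ≈ 0#) (p≡1+2e : p ≡ suc (2 ℕ.* e))
             (t^p≈t̄ : t ^ p ≈ t̄) (γ^e≈-1 : (a + (1# + 1#)) ^ e ≈ - 1#) where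
      private
        γ w : Carrier
        γ = a + (1# + 1#)
        w = t + 1#

        w²≈tγ : w * w ≈ t * γ
        w²≈tγ = begin
          w * w
            ≈⟨ solve 1 (λ t → (t :+ con 1) :* (t :+ con 1) := t :* t :+ (con 1 :+ con 1) :* t :+ con 1) refl t ⟩
          t * t + (1# + 1#) * t + 1#
            ≈⟨ +-congˡ tt̄≈1 ⟨
          t * t + (1# + 1#) * t + t * t̄
            ≈⟨ solve 2 (λ t t̄ → t :* t :+ (con 1 :+ con 1) :* t :+ t :* t̄
                             := t :* ((t :+ t̄) :+ (con 1 :+ con 1))) refl t t̄ ⟩
          t * ((t + t̄) + (1# + 1#))
            ≈⟨ *-congˡ (+-congʳ t+t̄≈a) ⟩
          t * γ ∎

        w[t̄+1]≈γ : w * (t̄ + 1#) ≈ γ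
        w[t̄+1]≈γ = begin
          w * (t̄ + 1#)
            ≈⟨ solve 2 (λ t t̄ → (t :+ con 1) :* (t̄ :+ con 1) := t :* t̄ :+ (t :+ t̄) :+ con 1) refl t t̄ ⟩
          t * t̄ + (t + t̄) + 1#
            ≈⟨ +-congʳ (+-cong tt̄≈1 t+t̄≈a) ⟩
          1# + a + 1#
            ≈⟨ solve 2 (λ a b → b :+ a :+ b := a :+ (b :+ b)) refl a 1# ⟩
          γ ∎

        w^p≈t̄+1 : w ^ p ≈ t̄ + 1#
        w^p≈t̄+1 = begin
          w ^ p              ≈⟨ [x+y]^p≈x^p+y^p commutativeSemiring p-prime p·1≈0 t 1# ⟩
          t ^ p + 1# ^ p     ≈⟨ +-cong t^p≈t̄ (1^n≈1 p) ⟩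
          t̄ + 1#             ∎

        w^p≈-wt^e : w ^ p ≈ w * (t ^ e * - 1#)
        w^p≈-wt^e = begin
          w ^ p                 ≡⟨ cong (w ^_) p≡1+2e ⟩
          w * w ^ (2 ℕ.* e)     ≈⟨ *-congˡ (^-assocʳ w 2 e) ⟨
          w * (w ^ 2) ^ e       ≈⟨ *-congˡ (^-congˡ e (*-congˡ (*-identityʳ w))) ⟩
          w * (w * w) ^ e       ≈⟨ *-congˡ (^-congˡ e w²≈tγ) ⟩
          w * (t * γ) ^ e       ≈⟨ *-congˡ (^-distrib-* t γ e) ⟩
          w * (t ^ e * γ ^ e)   ≈⟨ *-congˡ (*-congˡ γ^e≈-1) ⟩
          w * (t ^ e * - 1#)    ∎

        e≡1+pred-e : e ≡ suc (ℕ.pred e)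
        e≡1+pred-e = ≡.sym (ℕₚ.suc-pred e {{ℕ.≢-nonZero (1+2e-prime⇒e≢0 p-prime p≡1+2e)}})

        γ-unit : γ * - (γ ^ ℕ.pred e) ≈ 1#
        γ-unit = begin
          γ * - (γ ^ ℕ.pred e)     ≈⟨ -‿distribʳ-* γ (γ ^ ℕ.pred e) ⟨
          - (γ ^ suc (ℕ.pred e))   ≈⟨ -‿cong (^-congʳ γ e≡1+pred-e) ⟨
          - (γ ^ e)                ≈⟨ -‿cong γ^e≈-1 ⟩
          - - 1#                   ≈⟨ -‿involutive 1# ⟩
          1#                       ∎

        γ≈t^[1+e]γ*-1 : γ ≈ t ^ suc e * γ * - 1#
        γ≈t^[1+e]γ*-1 = begin
          γ                            ≈⟨ w[t̄+1]≈γ ⟨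
          w * (t̄ + 1#)                 ≈⟨ *-congˡ w^p≈t̄+1 ⟨
          w * w ^ p                    ≈⟨ *-congˡ w^p≈-wt^e ⟩
          w * (w * (t ^ e * - 1#))     ≈⟨ *-assoc w w _ ⟨
          w * w * (t ^ e * - 1#)       ≈⟨ *-congʳ w²≈tγ ⟩
          t * γ * (t ^ e * - 1#)       ≈⟨ solve 4 (λ t γ T N → t :* γ :* (T :* N) := t :* T :* γ :* N)
                                               refl t γ (t ^ e) (- 1#) ⟩
          t ^ suc e * γ * - 1#         ∎

      t^[1+e]≈-1 : t ^ suc e ≈ - 1#
      t^[1+e]≈-1 = *-cancelʳ-unit γ-unit (begin
        t ^ suc e * γ                    ≈⟨ *-identityʳ _ ⟨
        t ^ suc e * γ * 1#               ≈⟨ *-congˡ -1*-1≈1 ⟨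
        t ^ suc e * γ * (- 1# * - 1#)    ≈⟨ *-assoc _ (- 1#) (- 1#) ⟨
        t ^ suc e * γ * - 1# * - 1#      ≈⟨ *-congʳ γ≈t^[1+e]γ*-1 ⟨
        γ * - 1#                         ≈⟨ *-comm γ (- 1#) ⟩
        - 1# * γ                         ∎)

-- Quadratic extensions

module QuadraticExtension {c ℓ} (R : CommutativeRing c ℓ) (d : CommutativeRing.Carrier R) where
  open CommutativeRing R hiding (zero)
  open import Algebra.Properties.Semiring.Exp semiring using (_^_)
  open import Algebra.Construct.DirectProduct using (abelianGroup)
  open import Algebra.Solver.Ring.NaturalCoefficients.Default commutativeSemiring
  open import Data.Product using (zip; map)
  open import Data.Product.Relation.Binary.Pointwise.NonDependent using (Pointwise)

  Carrier² : Set c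
  Carrier² = Carrier × Carrier

  infix  4 _≈²_
  infixl 6 _+²_
  infixl 7 _*²_
  infix  8 -²_

  _≈²_ : Rel Carrier² ℓ
  _≈²_ = Pointwise _≈_ _≈_

  open import Algebra.Definitions _≈²_
    using (Associative; Commutative; LeftIdentity; RightIdentity; _DistributesOverˡ_; _DistributesOverʳ_)

  _+²_ : Carrier² → Carrier² → Carrier²
  _+²_ = zip _+_ _+_

  -²_ : Carrier² → Carrier²
  -²_ = map (-_) (-_)

  -- (a , b) represents a + b√d.
  _*²_ : Carrier² → Carrier² → Carrier²
  (a , b) *² (a′ , b′) = (a * a′ + d * (b * b′) , a * b′ + b * a′)

  ι : Carrier → Carrier²
  ι a = (a , 0#)

  √d : Carrier²
  √d = (0# , 1#)

  *²-cong : Congruent₂ _≈²_ _*²_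
  *²-cong (a≈ , b≈) (a′≈ , b′≈) =
    +-cong (*-cong a≈ a′≈) (*-congˡ (*-cong b≈ b′≈)) , +-cong (*-cong a≈ b′≈) (*-cong b≈ a′≈)

  *²-assoc : Associative _*²_
  *²-assoc (a , b) (a′ , b′) (a″ , b″) =
    solve 7 (λ a b a′ b′ a″ b″ d →
      (a :* a′ :+ d :* (b :* b′)) :* a″ :+ d :* ((a :* b′ :+ b :* a′) :* b″)
      := a :* (a′ :* a″ :+ d :* (b′ :* b″)) :+ d :* (b :* (a′ :* b″ :+ b′ :* a″)))
      refl a b a′ b′ a″ b″ d ,
    solve 7 (λ a b a′ b′ a″ b″ d →
      (a :* a′ :+ d :* (b :* b′)) :* b″ :+ (a :* b′ :+ b :* a′) :* a″
      := a :* (a′ :* b″ :+ b′ :* a″) :+ b :* (a′ :* a″ :+ d :* (b′ :* b″)))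
      refl a b a′ b′ a″ b″ d

  *²-comm : Commutative _*²_
  *²-comm (a , b) (a′ , b′) =
    solve 5 (λ a b a′ b′ d → a :* a′ :+ d :* (b :* b′) := a′ :* a :+ d :* (b′ :* b)) refl a b a′ b′ d ,
    solve 4 (λ a b a′ b′ → a :* b′ :+ b :* a′ := a′ :* b :+ b′ :* a) refl a b a′ b′

  *²-identityˡ : LeftIdentity (ι 1#) _*²_
  *²-identityˡ (a , b) =
    solve 3 (λ a b d → con 1 :* a :+ d :* (con 0 :* b) := a) refl a b d ,
    solve 2 (λ a b → con 1 :* b :+ con 0 :* a := b) refl a b

  *²-identityʳ : RightIdentity (ι 1#) _*²_
  *²-identityʳ (a , b) =
    solve 3 (λ a b d → a :* con 1 :+ d :* (b :* con 0) := a) refl a b d ,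
    solve 2 (λ a b → a :* con 0 :+ b :* con 1 := b) refl a b

  *²-distribˡ : _*²_ DistributesOverˡ _+²_
  *²-distribˡ (a , b) (a′ , b′) (a″ , b″) =
    solve 7 (λ a b a′ b′ a″ b″ d →
      a :* (a′ :+ a″) :+ d :* (b :* (b′ :+ b″)) := (a :* a′ :+ d :* (b :* b′)) :+ (a :* a″ :+ d :* (b :* b″)))
      refl a b a′ b′ a″ b″ d ,
    solve 6 (λ a b a′ b′ a″ b″ →
      a :* (b′ :+ b″) :+ b :* (a′ :+ a″) := (a :* b′ :+ b :* a′) :+ (a :* b″ :+ b :* a″))
      refl a b a′ b′ a″ b″

  *²-distribʳ : _*²_ DistributesOverʳ _+²_
  *²-distribʳ (a , b) (a′ , b′) (a″ , b″) =
    solve 7 (λ a b a′ b′ a″ b″ d →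
      (a′ :+ a″) :* a :+ d :* ((b′ :+ b″) :* b) := (a′ :* a :+ d :* (b′ :* b)) :+ (a″ :* a :+ d :* (b″ :* b)))
      refl a b a′ b′ a″ b″ d ,
    solve 6 (λ a b a′ b′ a″ b″ →
      (a′ :+ a″) :* b :+ (b′ :+ b″) :* a := (a′ :* b :+ b′ :* a) :+ (a″ :* b :+ b″ :* a))
      refl a b a′ b′ a″ b″

  commutativeRing² : CommutativeRing c ℓ
  commutativeRing² = record
    { Carrier = Carrier² ; _≈_ = _≈²_ ; _+_ = _+²_ ; _*_ = _*²_ ; -_ = -²_ ; 0# = ι 0# ; 1# = ι 1#
    ; isCommutativeRing = record
      { isRing = record
        { +-isAbelianGroup = AbelianGroup.isAbelianGroup (abelianGroup +-abelianGroup +-abelianGroup)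
        ; *-cong = *²-cong
        ; *-assoc = *²-assoc
        ; *-identity = *²-identityˡ , *²-identityʳ
        ; distrib = *²-distribˡ , *²-distribʳ }
      ; *-comm = *²-comm } }

  module E = CommutativeRing commutativeRing²
  open import Algebra.Properties.Semiring.Exp E.semiring public using () renaming (_^_ to _^²_)
  open import Algebra.Properties.Semiring.Mult E.semiring public using () renaming (_×_ to _·²_)
  open import Algebra.Properties.Semiring.Mult semiring using () renaming (_×_ to _·_)
  open import Algebra.Properties.Ring ring using (-‿distribʳ-*)

  conj : Carrier² → Carrier²
  conj (a , b) = (a , - b)

  norm : Carrier² → Carrier
  norm (a , b) = a * a - d * (b * b)

  ι-*ˡ : ∀ a u → ι a *² u ≈² (a * proj₁ u , a * proj₂ u)
  ι-*ˡ a (b , b′) = trans (+-congˡ (trans (*-congˡ (zeroˡ b′)) (zeroʳ d))) (+-identityʳ _) ,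
                    trans (+-congˡ (zeroˡ b)) (+-identityʳ _)

  ι-* : ∀ a b → ι a *² ι b ≈² ι (a * b)
  ι-* a b = E.trans (ι-*ˡ a (ι b)) (refl , zeroʳ a)

  ι-^ : ∀ a n → ι a ^² n ≈² ι (a ^ n)
  ι-^ a zero    = E.refl
  ι-^ a (suc n) = E.trans (*²-cong E.refl (ι-^ a n)) (ι-* a (a ^ n))

  √d*√d : √d *² √d ≈² ι d
  √d*√d = trans (+-cong (zeroˡ 0#) (trans (*-congˡ (*-identityˡ 1#)) (*-identityʳ d))) (+-identityˡ d) ,
          trans (+-cong (zeroˡ 1#) (zeroʳ 1#)) (+-identityʳ 0#)

  decompose : ∀ a b → ι a +² ι b *² √d ≈² (a , b)
  decompose a b = E.trans (E.+-congˡ (ι-*ˡ b √d))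
    (trans (+-congˡ (zeroʳ b)) (+-identityʳ a) , trans (+-identityˡ _) (*-identityʳ b))

  ι-·1 : ∀ n → n ·² E.1# ≈² ι (n · 1#)
  ι-·1 zero    = E.refl
  ι-·1 (suc n) = E.trans (E.+-congˡ (ι-·1 n)) (refl , +-identityʳ 0#)

  *-conj : ∀ u → u *² conj u ≈² ι (norm u)
  *-conj (a , b) =
    +-congˡ (trans (*-congˡ (sym (-‿distribʳ-* b b))) (sym (-‿distribʳ-* d (b * b)))) ,
    trans (+-cong (sym (-‿distribʳ-* a b)) (*-comm b a)) (-‿inverseˡ (a * b))

-- Products over finite sets of naturals

module _ where
  open import Data.Nat using (_<_; _≟_)
  open import Data.Nat.Properties

  remove : ℕ → (ℕ → Bool) → (ℕ → Bool)
  remove y S z = S z ∧ not ⌊ z ≟ y ⌋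

  remove-≢ : ∀ {y S z} → z ≢ y → remove y S z ≡ S z
  remove-≢ {y} {S} {z} z≢y with z ≟ y
  ... | yes z≡y = contradiction z≡y z≢y
  ... | no _    = ∧-identityʳ (S z)

  remove-self : ∀ y S → remove y S y ≡ false
  remove-self y S with y ≟ y
  ... | yes _   = ∧-zeroʳ (S y)
  ... | no y≢y  = contradiction ≡.refl y≢y

  remove-true : ∀ {y S z} → remove y S z ≡ true → S z ≡ true × z ≢ y
  remove-true {y} {S} {z} h with z ≟ y
  ... | yes _   = contradiction (≡.trans (≡.sym (∧-zeroʳ (S z))) h) λ ()
  ... | no z≢y  = ≡.trans (≡.sym (∧-identityʳ (S z))) h , z≢y

  sizeBelow : (ℕ → Bool) → ℕ → ℕ
  sizeBelow S zero    = 0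
  sizeBelow S (suc n) = if S n then suc (sizeBelow S n) else sizeBelow S n

  sizeBelow-all : ∀ n → sizeBelow (const true) n ≡ n
  sizeBelow-all zero    = ≡.refl
  sizeBelow-all (suc n) = cong suc (sizeBelow-all n)

  sizeBelow-cong : ∀ {S S′} n → (∀ {z} → z < n → S z ≡ S′ z) → sizeBelow S n ≡ sizeBelow S′ n
  sizeBelow-cong zero    S≗S′ = ≡.refl
  sizeBelow-cong {S} {S′} (suc n) S≗S′
    with sizeBelow-cong n (λ z<n → S≗S′ (m<n⇒m<1+n z<n)) | S n | S′ n | S≗S′ (n<1+n n)
  ... | #≡ | true  | true  | _ = cong suc #≡
  ... | #≡ | false | false | _ = #≡

  sizeBelow-remove : ∀ {y S} n → y < n → S y ≡ true → sizeBelow S n ≡ suc (sizeBelow (remove y S) n)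
  sizeBelow-remove {y} {S} (suc n) y<1+n Sy with y ≟ n
  ... | yes ≡.refl = ≡.trans (if-cong Sy) (cong suc (≡.trans unchanged (≡.sym (if-cong (remove-self y S)))))
    where unchanged = sizeBelow-cong {S} {remove y S} y λ z<y → ≡.sym (remove-≢ {S = S} (<⇒≢ z<y))
  ... | no y≢n rewrite remove-≢ {S = S} (≡.≢-sym y≢n) with S n | sizeBelow-remove n (≤∧≢⇒< (≤-pred y<1+n) y≢n) Sy
  ...   | true  | #≡ = cong suc #≡
  ...   | false | #≡ = #≡

  sizeBelow≢0⇒member : ∀ {S k} n → sizeBelow S n ≡ suc k → ∃[ y ] y < n × S y ≡ true
  sizeBelow≢0⇒member {S} (suc n) h with S n in Sn
  ... | true  = n , n<1+n n , Sn
  ... | false with sizeBelow≢0⇒member n h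
  ...   | y , y<n , Sy = y , m<n⇒m<1+n y<n , Sy

module _ {c ℓ} (M : CommutativeMonoid c ℓ) (f : ℕ → CommutativeMonoid.Carrier M) where
  open CommutativeMonoid M
  open import Algebra.Definitions.RawMonoid rawMonoid using () renaming (_×_ to _·_)
  open import Algebra.Properties.CommutativeSemigroup commutativeSemigroup using (x∙yz≈y∙xz)
  open import Data.Nat using (_<_; _≟_)
  open import Data.Nat.Properties
  open import Relation.Binary.Reasoning.Setoid setoid

  productBelow : (ℕ → Bool) → ℕ → Carrier
  productBelow S zero    = ε
  productBelow S (suc n) = if S n then f n ∙ productBelow S n else productBelow S n

  productBelow-cong : ∀ {S S′} n → (∀ {z} → z < n → S z ≡ S′ z) → productBelow S n ≡ productBelow S′ n
  productBelow-cong zero    S≗S′ = ≡.refl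
  productBelow-cong {S} {S′} (suc n) S≗S′
    with productBelow-cong n (λ z<n → S≗S′ (m<n⇒m<1+n z<n)) | S n | S′ n | S≗S′ (n<1+n n)
  ... | ∏≡ | true  | true  | _ = cong (f n ∙_) ∏≡
  ... | ∏≡ | false | false | _ = ∏≡

  productBelow-remove : ∀ {y S} n → y < n → S y ≡ true →
                        productBelow S n ≈ f y ∙ productBelow (remove y S) n
  productBelow-remove {y} {S} (suc n) y<1+n Sy with y ≟ n
  ... | yes ≡.refl = reflexive (≡.trans (if-cong Sy) (cong (f y ∙_) (≡.trans unchanged (≡.sym (if-cong (remove-self y S))))))
    where unchanged = productBelow-cong {S} {remove y S} y λ z<y → ≡.sym (remove-≢ {S = S} (<⇒≢ z<y))
  ... | no y≢n rewrite remove-≢ {S = S} (≡.≢-sym y≢n) with S n | productBelow-remove n (≤∧≢⇒< (≤-pred y<1+n) y≢n) Sy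
  ...   | true  | ∏≈ = trans (∙-congˡ ∏≈) (x∙yz≈y∙xz (f n) (f y) _)
  ...   | false | ∏≈ = ∏≈

  sizeBelow≡0⇒productBelow≡ε : ∀ {S} n → sizeBelow S n ≡ 0 → productBelow S n ≡ ε
  sizeBelow≡0⇒productBelow≡ε zero    _ = ≡.refl
  sizeBelow≡0⇒productBelow≡ε {S} (suc n) h with S n
  ... | false = sizeBelow≡0⇒productBelow≡ε n h

  PairedOffBelow : ℕ → (ℕ → ℕ) → Carrier → (ℕ → Bool) → Set ℓ
  PairedOffBelow n σ a S = ∀ {y} → y < n → S y ≡ true →
    σ y < n × S (σ y) ≡ true × σ y ≢ y × σ (σ y) ≡ y × f y ∙ f (σ y) ≈ a

  module _ {n : ℕ} {σ : ℕ → ℕ} {a : Carrier} where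
    private
      remove-pair : ∀ {S y} → PairedOffBelow n σ a S → y < n → S y ≡ true →
        let S′ = remove (σ y) (remove y S) in
        productBelow S n ≈ a ∙ productBelow S′ n × sizeBelow S n ≡ suc (suc (sizeBelow S′ n)) ×
        PairedOffBelow n σ a S′
      remove-pair {S} {y} paired y<n Sy with paired y<n Sy
      ... | σy<n , Sσy , σy≢y , σσy≡y , fyfσy≈a = ∏≈ , #≡ , paired′
        where
        S₁ = remove y S
        S₁σy : S₁ (σ y) ≡ true
        S₁σy = ≡.trans (remove-≢ {S = S} σy≢y) Sσy
        ∏≈ = begin
          productBelow S n                                        ≈⟨ productBelow-remove n y<n Sy ⟩
          f y ∙ productBelow S₁ n                                 ≈⟨ ∙-congˡ (productBelow-remove n σy<n S₁σy) ⟩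
          f y ∙ (f (σ y) ∙ productBelow (remove (σ y) S₁) n)      ≈⟨ assoc _ _ _ ⟨
          f y ∙ f (σ y) ∙ productBelow (remove (σ y) S₁) n        ≈⟨ ∙-congʳ fyfσy≈a ⟩
          a ∙ productBelow (remove (σ y) S₁) n                    ∎
        #≡ = ≡.trans (sizeBelow-remove n y<n Sy) (cong suc (sizeBelow-remove n σy<n S₁σy))
        paired′ : PairedOffBelow n σ a (remove (σ y) S₁)
        paired′ {z} z<n S′z with remove-true {S = S₁} S′z
        ... | S₁z , z≢σy with remove-true {S = S} S₁z
        ...   | Sz , z≢y with paired z<n Sz
        ...     | σz<n , Sσz , σz≢z , σσz≡z , fzfσz≈a =
          σz<n , ≡.trans (remove-≢ {S = S₁} σz≢σy) (≡.trans (remove-≢ {S = S} σz≢y) Sσz) , σz≢z , σσz≡z , fzfσz≈a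
          where
          σz≢y : σ z ≢ y
          σz≢y σz≡y = z≢σy (≡.trans (≡.sym σσz≡z) (cong σ σz≡y))
          σz≢σy : σ z ≢ σ y
          σz≢σy σz≡σy = z≢y (≡.trans (≡.sym σσz≡z) (≡.trans (cong σ σz≡σy) σσy≡y))

      pairing′ : ∀ k {S} → sizeBelow S n ≡ k → PairedOffBelow n σ a S →
                 ∃[ j ] k ≡ 2 ℕ.* j × productBelow S n ≈ j · a
      pairing′ zero          #≡0 _      = 0 , ≡.refl , reflexive (sizeBelow≡0⇒productBelow≡ε n #≡0)
      pairing′ (suc k) {S} #≡1+k paired with sizeBelow≢0⇒member n #≡1+k
      ... | y , y<n , Sy with remove-pair paired y<n Sy
      ...   | ∏≈ , #≡ , paired′ with k | ≡.trans (≡.sym #≡1+k) #≡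
      ...     | zero   | ()
      ...     | suc k′ | 2+k′≡2+#S′ with pairing′ k′ (≡.sym (suc-injective (suc-injective 2+k′≡2+#S′))) paired′
      ...       | j , k′≡2j , ∏′≈ja =
        suc j , cong suc (≡.trans (cong suc k′≡2j) (≡.sym (+-suc j (j ℕ.+ 0)))) , trans ∏≈ (∙-congˡ ∏′≈ja)

    pairing : ∀ {S} → PairedOffBelow n σ a S → ∃[ j ] sizeBelow S n ≡ 2 ℕ.* j × productBelow S n ≈ j · a
    pairing = pairing′ _ ≡.refl

module ResidueRing (p : ℕ) .{{_ : NonZero p}} where
  open import Data.Nat using (_+_; _*_; _∸_; _<_; _≟_)
  open import Data.Nat.DivMod
  open import Data.Nat.Divisibility using (_∣_; m%n≡0⇒n∣m; n∣m⇒m%n≡0)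
  open import Data.Nat.Properties
  open import Algebra.Structures using (IsCommutativeRing)
  open ≡.≡-Reasoning

  infix 4 _≈_
  _≈_ : Rel ℕ 0ℓ
  m ≈ n = m % p ≡ n % p

  ≡⇒≈ : ∀ {m n} → m ≡ n → m ≈ n
  ≡⇒≈ = cong (_% p)

  _≈?_ : ∀ m n → Dec (m ≈ n)
  m ≈? n = m % p ≟ n % p

  %-≈ : ∀ m → m % p ≈ m
  %-≈ m = m%n%n≡m%n m p

  0%p≡0 : 0 % p ≡ 0
  0%p≡0 = m*n%n≡0 0 p

  ≈0⇒∣ : ∀ {m} → m ≈ 0 → p ∣ m
  ≈0⇒∣ {m} m≈0 = m%n≡0⇒n∣m m p (≡.trans m≈0 0%p≡0)

  ∣⇒≈0 : ∀ {m} → p ∣ m → m ≈ 0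
  ∣⇒≈0 {m} p∣m = ≡.trans (n∣m⇒m%n≡0 m p p∣m) (≡.sym 0%p≡0)

  ≈⇒≡ : ∀ {m n} → m < p → n < p → m ≈ n → m ≡ n
  ≈⇒≡ m<p n<p m≈n = ≡.trans (≡.sym (m<n⇒m%n≡m m<p)) (≡.trans m≈n (m<n⇒m%n≡m n<p))

  -- The ring operations are opaque, so that unification sees ring terms and not their ℕ unfoldings.
  infixl 6 _⊕_
  infixl 7 _⊗_
  infix  8 ⊖_

  opaque
    _⊕_ _⊗_ : ℕ → ℕ → ℕ
    _⊕_ = _+_
    _⊗_ = _*_

    ⊖_ : ℕ → ℕ
    ⊖ m = p ∸ m % p

    ⊕≡+ : ∀ m n → m ⊕ n ≡ m + n
    ⊕≡+ m n = ≡.refl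

    ⊗≡* : ∀ m n → m ⊗ n ≡ m * n
    ⊗≡* m n = ≡.refl

    ⊖≡∸ : ∀ m → ⊖ m ≡ p ∸ m % p
    ⊖≡∸ m = ≡.refl

    subP≈ : ∀ m n → subP p m n ≈ m ⊕ ⊖ n
    subP≈ m n = %-≈ (m + ⊖ n)

    ⊕-cong : Congruent₂ _≈_ _⊕_
    ⊕-cong {a} {b} {c} {d} a≈b c≈d = begin
      (a + c) % p             ≡⟨ %-distribˡ-+ a c p ⟩
      (a % p + c % p) % p     ≡⟨ cong₂ (λ m n → (m + n) % p) a≈b c≈d ⟩
      (b % p + d % p) % p     ≡⟨ %-distribˡ-+ b d p ⟨
      (b + d) % p             ∎

    ⊗-cong : Congruent₂ _≈_ _⊗_
    ⊗-cong {a} {b} {c} {d} a≈b c≈d = begin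
      (a * c) % p             ≡⟨ %-distribˡ-* a c p ⟩
      (a % p * (c % p)) % p   ≡⟨ cong₂ (λ m n → (m * n) % p) a≈b c≈d ⟩
      (b % p * (d % p)) % p   ≡⟨ %-distribˡ-* b d p ⟨
      (b * d) % p             ∎

    ⊖-inverseʳ : ∀ m → m ⊕ ⊖ m ≈ 0
    ⊖-inverseʳ m = begin
      (m + ⊖ m) % p           ≡⟨ ⊕-cong (%-≈ m) ≡.refl ⟨
      (m % p + ⊖ m) % p       ≡⟨ cong (_% p) (m+[n∸m]≡n (m%n≤n m p)) ⟩
      p % p                   ≡⟨ n%n≡0 p ⟩
      0                       ≡⟨ 0%p≡0 ⟨
      0 % p                   ∎

    isCommutativeRing : IsCommutativeRing _≈_ _⊕_ _⊗_ ⊖_ 0 1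
    isCommutativeRing = record
      { isRing = record
        { +-isAbelianGroup = record
          { isGroup = record
            { isMonoid = record
              { isSemigroup = record
                { isMagma = record { isEquivalence = On.isEquivalence (_% p) ≡.isEquivalence ; ∙-cong = ⊕-cong }
                ; assoc = λ a b c → ≡⇒≈ (+-assoc a b c) }
              ; identity = (λ a → ≡.refl) , λ a → ≡⇒≈ (+-identityʳ a) }
            ; inverse = (λ a → ≡.trans (≡⇒≈ (+-comm (⊖ a) a)) (⊖-inverseʳ a)) , ⊖-inverseʳ
            ; ⁻¹-cong = cong (λ r → (p ∸ r) % p) }
          ; comm = λ a b → ≡⇒≈ (+-comm a b) }
        ; *-cong = ⊗-cong
        ; *-assoc = λ a b c → ≡⇒≈ (*-assoc a b c)
        ; *-identity = (λ a → ≡⇒≈ (*-identityˡ a)) , λ a → ≡⇒≈ (*-identityʳ a)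
        ; distrib = (λ a b c → ≡⇒≈ (*-distribˡ-+ a b c)) , λ a b c → ≡⇒≈ (*-distribʳ-+ a b c) }
      ; *-comm = λ a b → ≡⇒≈ (*-comm a b) }

  commutativeRing : CommutativeRing 0ℓ 0ℓ
  commutativeRing = record { isCommutativeRing = isCommutativeRing }

-- Fermat, Wilson and Euler

module PrimeField (p : ℕ) (p-prime : Prime p) where
  private instance p≢0 = prime⇒nonZero p-prime
  open ResidueRing p using (commutativeRing; ≡⇒≈; _≈?_; %-≈; 0%p≡0; ≈0⇒∣; ∣⇒≈0; ≈⇒≡; ⊕≡+; ⊗≡*; ⊖≡∸; subP≈) public
  open CommutativeRing commutativeRing hiding (zero)
  open import Algebra.Properties.Ring ring using (x∙y⁻¹≈ε⇒x≈y; x≈y⇒x∙y⁻¹≈ε; [y-z]x≈yx-zx; +-inverseˡ-unique)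
  open import Algebra.Properties.Semiring.Exp semiring using (_^_; ^-congʳ; ^-congˡ)
  open import Algebra.Properties.Semiring.Mult semiring using () renaming (_×_ to _·_)
  open import Data.Nat.DivMod using (_%_; m%n<n; n%n≡0; m<n⇒m%n≡m)
  open import Relation.Binary.Reasoning.Setoid setoid

  1<p : 1 ℕ.< p
  1<p = ℕ.nonTrivial⇒n>1 p {{prime⇒nonTrivial p-prime}}

  0<p : 0 ℕ.< p
  0<p = ℕₚ.<-trans (ℕ.s≤s ℕ.z≤n) 1<p

  *-integral : ∀ {x y} → x * y ≈ 0# → x ≈ 0# ⊎ y ≈ 0#
  *-integral {x} {y} xy≈0 with euclidsLemma x y p-prime (≈0⇒∣ (trans (≡⇒≈ (≡.sym (⊗≡* x y))) xy≈0))
  ... | inj₁ p∣x = inj₁ (∣⇒≈0 p∣x)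
  ... | inj₂ p∣y = inj₂ (∣⇒≈0 p∣y)

  *-cancelʳ-≉0 : ∀ {x y z} → z ≉ 0# → x * z ≈ y * z → x ≈ y
  *-cancelʳ-≉0 {x} {y} {z} z≉0 xz≈yz with *-integral [x-y]z≈0
    where
    [x-y]z≈0 : (x - y) * z ≈ 0#
    [x-y]z≈0 = trans ([y-z]x≈yx-zx z x y) (x≈y⇒x∙y⁻¹≈ε xz≈yz)
  ... | inj₁ x-y≈0 = x∙y⁻¹≈ε⇒x≈y x y x-y≈0
  ... | inj₂ z≈0   = contradiction z≈0 z≉0

  p·1≈0 : p · 1# ≈ 0#
  p·1≈0 = ≡.trans (cong (_% p) (n·1≡n p)) (≡.trans (n%n≡0 p) (≡.sym 0%p≡0))
    where
    n·1≡n : ∀ n → n · 1# ≡ n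
    n·1≡n zero    = ≡.refl
    n·1≡n (suc n) = ≡.trans (⊕≡+ 1 (n · 1#)) (cong suc (n·1≡n n))

  fermat : ∀ x → x ^ p ≈ x
  fermat zero    = begin
    0 ^ p                ≈⟨ ^-congʳ 0 (ℕₚ.suc-pred p) ⟨
    0 * 0 ^ ℕ.pred p     ≈⟨ zeroˡ (0 ^ ℕ.pred p) ⟩
    0                    ∎
  fermat (suc x) = begin
    suc x ^ p            ≈⟨ ^-congˡ p 1+x≈suc-x ⟨
    (1 + x) ^ p          ≈⟨ [x+y]^p≈x^p+y^p commutativeSemiring p-prime p·1≈0 1 x ⟩
    1 ^ p + x ^ p        ≈⟨ +-cong (1^n≈1 commutativeRing p) (fermat x) ⟩
    1 + x                ≈⟨ 1+x≈suc-x ⟩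
    suc x                ∎
    where
    1+x≈suc-x : 1 + x ≈ suc x
    1+x≈suc-x = ≡⇒≈ (⊕≡+ 1 x)

  1≉0 : 1# ≉ 0#
  1≉0 1≈0 = ℕₚ.1+n≢0 (≡.trans (≡.sym (m<n⇒m%n≡m 1<p)) (≡.trans 1≈0 0%p≡0))

  <p∧≢0⇒≉0 : ∀ {x} → x ℕ.< p → x ≢ 0 → x ≉ 0#
  <p∧≢0⇒≉0 x<p x≢0 x≈0 = x≢0 (≈⇒≡ x<p 0<p x≈0)

  _⁻¹ : ℕ → ℕ
  x ⁻¹ = x ^ (p ℕ.∸ 2) % p

  x*x⁻¹≈1 : ∀ {x} → x ≉ 0# → x * x ⁻¹ ≈ 1#
  x*x⁻¹≈1 {x} x≉0 = *-cancelʳ-≉0 x≉0 (begin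
    x * x ⁻¹ * x                ≈⟨ *-congʳ (*-congˡ (%-≈ _)) ⟩
    x * x ^ (p ℕ.∸ 2) * x       ≈⟨ *-comm _ x ⟩
    x ^ (2 ℕ.+ (p ℕ.∸ 2))       ≡⟨ cong (x ^_) (ℕₚ.m+[n∸m]≡n 1<p) ⟩
    x ^ p                       ≈⟨ fermat x ⟩
    x                           ≈⟨ *-identityˡ x ⟨
    1# * x                      ∎)

  x*x≈1⇒x≈±1 : ∀ {x} → x * x ≈ 1# → x ≈ 1# ⊎ x ≈ - 1#
  x*x≈1⇒x≈±1 {x} x*x≈1 with *-integral [x-1][x+1]≈0
    where
    [x-1][x+1]≈0 : (x - 1#) * (x + 1#) ≈ 0#
    [x-1][x+1]≈0 = begin
      (x - 1#) * (x + 1#)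
        ≈⟨ solve 2 (λ x n → (x :+ n) :* (x :+ con 1) := x :* x :+ (n :+ con 1) :* x :+ n) refl x (- 1#) ⟩
      x * x + (- 1# + 1#) * x + - 1#
        ≈⟨ +-congʳ (+-cong x*x≈1 (trans (*-congʳ (-‿inverseˡ 1#)) (zeroˡ x))) ⟩
      1# + 0# + - 1#
        ≈⟨ +-congʳ (+-identityʳ 1#) ⟩
      1# - 1#
        ≈⟨ -‿inverseʳ 1# ⟩
      0# ∎
      where open import Algebra.Solver.Ring.NaturalCoefficients.Default commutativeSemiring
  ... | inj₁ x-1≈0 = inj₁ (x∙y⁻¹≈ε⇒x≈y x 1# x-1≈0)
  ... | inj₂ x+1≈0 = inj₂ (+-inverseˡ-unique x 1# x+1≈0)

  infixl 7 _÷_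
  _÷_ : ℕ → ℕ → ℕ
  a ÷ y = a * y ⁻¹ % p

  ÷<p : ∀ a y → a ÷ y ℕ.< p
  ÷<p a y = m%n<n _ p

  *-÷ : ∀ a {y} → y ≉ 0# → y * (a ÷ y) ≈ a
  *-÷ a {y} y≉0 = begin
    y * (a ÷ y)        ≈⟨ *-congˡ (%-≈ _) ⟩
    y * (a * y ⁻¹)     ≈⟨ x∙yz≈y∙xz y a (y ⁻¹) ⟩
    a * (y * y ⁻¹)     ≈⟨ *-congˡ (x*x⁻¹≈1 y≉0) ⟩
    a * 1#             ≈⟨ *-identityʳ a ⟩
    a                  ∎
    where open import Algebra.Properties.CommutativeSemigroup *-commutativeSemigroup using (x∙yz≈y∙xz)

  ÷-≉0 : ∀ {a y} → a ≉ 0# → y ≉ 0# → a ÷ y ≉ 0#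
  ÷-≉0 {a} {y} a≉0 y≉0 a÷y≈0 = a≉0 (begin
    a              ≈⟨ *-÷ a y≉0 ⟨
    y * (a ÷ y)    ≈⟨ *-congˡ a÷y≈0 ⟩
    y * 0#         ≈⟨ zeroʳ y ⟩
    0#             ∎)

  ÷-unique : ∀ a {y z} → z ℕ.< p → y ≉ 0# → y * z ≈ a → a ÷ y ≡ z
  ÷-unique a {y} {z} z<p y≉0 yz≈a =
    ≈⇒≡ (÷<p a y) z<p (*-cancelʳ-≉0 y≉0 (trans (*-comm (a ÷ y) y) (trans (*-÷ a y≉0) (trans (sym yz≈a) (*-comm y z)))))

  ÷-involutive : ∀ {a y} → y ℕ.< p → a ≉ 0# → y ≉ 0# → a ÷ (a ÷ y) ≡ y
  ÷-involutive {a} {y} y<p a≉0 y≉0 = ÷-unique a y<p (÷-≉0 a≉0 y≉0) (trans (*-comm (a ÷ y) y) (*-÷ a y≉0))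

  nonzero : ℕ → Bool
  nonzero = remove 0 (const true)

  module _ {e} (p≡1+2e : p ≡ suc (2 ℕ.* e)) where
    ∏ : (ℕ → Bool) → ℕ
    ∏ S = productBelow *-commutativeMonoid id S p

    private
      m₁ : ℕ
      m₁ = p ℕ.∸ 1

      m₁<p : m₁ ℕ.< p
      m₁<p = subst (m₁ ℕ.<_) (ℕₚ.suc-pred p) (ℕₚ.n<1+n m₁)

      m₁≈-1 : m₁ ≈ - 1#
      m₁≈-1 = ≡⇒≈ (≡.sym (≡.trans (⊖≡∸ 1) (cong (p ℕ.∸_) (m<n⇒m%n≡m 1<p))))

      2≤m₁ : 2 ℕ.≤ m₁
      2≤m₁ = subst (2 ℕ.≤_) (cong (ℕ._∸ 1) (≡.sym p≡1+2e))
               (ℕₚ.*-monoʳ-≤ 2 {1} {e} (ℕₚ.n≢0⇒n>0 (1+2e-prime⇒e≢0 p-prime p≡1+2e)))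

      m₁≢0 : m₁ ≢ 0
      m₁≢0 m₁≡0 = ℕₚ.<⇒≱ (ℕ.s≤s ℕ.z≤n) (subst (2 ℕ.≤_) m₁≡0 2≤m₁)

      m₁≢1 : m₁ ≢ 1
      m₁≢1 m₁≡1 = ℕₚ.<⇒≱ (ℕ.s≤s (ℕ.s≤s ℕ.z≤n)) (subst (2 ℕ.≤_) m₁≡1 2≤m₁)

      nonzero⇒≉0 : ∀ {y} → y ℕ.< p → nonzero y ≡ true → y ≉ 0#
      nonzero⇒≉0 y<p nz-y = <p∧≢0⇒≉0 y<p (proj₂ (remove-true {S = const true} nz-y))

    wilson : ∏ nonzero ≈ - 1#
    wilson = begin
      ∏ nonzero          ≈⟨ productBelow-remove *-commutativeMonoid id p 1<p ≡.refl ⟩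
      1 * ∏ S₁           ≈⟨ *-identityˡ _ ⟩
      ∏ S₁               ≈⟨ productBelow-remove *-commutativeMonoid id p m₁<p S₁m₁ ⟩
      m₁ * ∏ S₂          ≈⟨ *-cong m₁≈-1 ∏S₂≈1 ⟩
      - 1# * 1#          ≈⟨ *-identityʳ (- 1#) ⟩
      - 1#               ∎
      where
      S₁ = remove 1 nonzero
      S₂ = remove m₁ S₁
      S₁m₁ : S₁ m₁ ≡ true
      S₁m₁ = ≡.trans (remove-≢ {S = nonzero} m₁≢1) (remove-≢ {S = const true} m₁≢0)
      m₁*m₁≈1 : m₁ * m₁ ≈ 1#
      m₁*m₁≈1 = trans (*-cong m₁≈-1 m₁≈-1) (-1*-1≈1 commutativeRing)
      S₂-intro : ∀ {y} → y ≢ 0 → y ≢ 1 → y ≢ m₁ → S₂ y ≡ true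
      S₂-intro y≢0 y≢1 y≢m₁ =
        ≡.trans (remove-≢ {S = S₁} y≢m₁) (≡.trans (remove-≢ {S = nonzero} y≢1) (remove-≢ {S = const true} y≢0))
      paired : PairedOffBelow *-commutativeMonoid id p (1 ÷_) 1# S₂
      paired {y} y<p S₂y with remove-true {S = S₁} S₂y
      ... | S₁y , y≢m₁ with remove-true {S = nonzero} S₁y
      ...   | nz-y , y≢1 =
        ÷<p 1 y , S₂-intro 1÷y≢0 1÷y≢1 1÷y≢m₁ , 1÷y≢y , ÷-involutive y<p 1≉0 y≉0 , *-÷ 1 y≉0
        where
        y≉0 = nonzero⇒≉0 y<p nz-y
        1÷y≡⇒y≡ : ∀ {z} → z ℕ.< p → z * z ≈ 1# → 1 ÷ y ≡ z → y ≡ z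
        1÷y≡⇒y≡ {z} z<p zz≈1 1÷y≡z =
          ≡.trans (≡.sym (÷-involutive y<p 1≉0 y≉0)) (≡.trans (cong (1 ÷_) 1÷y≡z) (÷-unique 1 z<p z≉0 zz≈1))
          where
          z≉0 : z ≉ 0#
          z≉0 z≈0 = 1≉0 (trans (sym zz≈1) (trans (*-congˡ z≈0) (zeroʳ z)))
        1÷y≢0 : 1 ÷ y ≢ 0
        1÷y≢0 1÷y≡0 = ÷-≉0 1≉0 y≉0 (≡⇒≈ 1÷y≡0)
        1÷y≢1 : 1 ÷ y ≢ 1
        1÷y≢1 = y≢1 ∘ 1÷y≡⇒y≡ 1<p (*-identityˡ 1#)
        1÷y≢m₁ : 1 ÷ y ≢ m₁
        1÷y≢m₁ = y≢m₁ ∘ 1÷y≡⇒y≡ m₁<p m₁*m₁≈1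
        1÷y≢y : 1 ÷ y ≢ y
        1÷y≢y 1÷y≡y with x*x≈1⇒x≈±1 (trans (*-congˡ (≡⇒≈ (≡.sym 1÷y≡y))) (*-÷ 1 y≉0))
        ... | inj₁ y≈1  = y≢1 (≈⇒≡ y<p 1<p y≈1)
        ... | inj₂ y≈-1 = y≢m₁ (≈⇒≡ y<p m₁<p (trans y≈-1 (sym m₁≈-1)))
      ∏S₂≈1 : ∏ S₂ ≈ 1#
      ∏S₂≈1 with pairing *-commutativeMonoid id paired
      ... | j , _ , ∏S₂≈1^j = trans ∏S₂≈1^j (1^n≈1 commutativeRing j)

    euler : ∀ {a} → a ≉ 0# → ¬ IsSquareModP p a → a ^ e ≈ - 1#
    euler {a} a≉0 a-nonsquare with pairing *-commutativeMonoid id paired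
      where
      paired : PairedOffBelow *-commutativeMonoid id p (a ÷_) a nonzero
      paired {y} y<p nz-y =
        ÷<p a y , ≡.trans (remove-≢ {S = const true} (λ a÷y≡0 → ÷-≉0 a≉0 y≉0 (≡⇒≈ a÷y≡0))) ≡.refl ,
        a÷y≢y , ÷-involutive y<p a≉0 y≉0 , *-÷ a y≉0
        where
        y≉0 = nonzero⇒≉0 y<p nz-y
        a÷y≢y : a ÷ y ≢ y
        a÷y≢y a÷y≡y = a-nonsquare (y , y<p , trans (≡⇒≈ (≡.sym (⊗≡* y y)))
                                              (trans (*-congˡ (≡⇒≈ (≡.sym a÷y≡y))) (*-÷ a y≉0)))
    ... | j , #≡2j , ∏≈a^j = begin
      a ^ e           ≡⟨ cong (a ^_) e≡j ⟩
      a ^ j           ≈⟨ ∏≈a^j ⟨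
      ∏ nonzero       ≈⟨ wilson ⟩
      - 1#            ∎
      where
      p≡1+#nonzero : p ≡ suc (sizeBelow nonzero p)
      p≡1+#nonzero = ≡.trans (≡.sym (sizeBelow-all p)) (sizeBelow-remove p 0<p ≡.refl)
      e≡j : e ≡ j
      e≡j = ℕₚ.*-cancelˡ-≡ e j 2 (ℕₚ.suc-injective (≡.trans (≡.sym p≡1+2e) (≡.trans p≡1+#nonzero (cong suc #≡2j))))

module NonsquareExtension (p : ℕ) (p-prime : Prime p) (d : ℕ)
                          (d-nonsquare : ¬ IsSquareModP p {{prime⇒nonZero p-prime}} d) where
  private instance p≢0 = prime⇒nonZero p-prime
  open PrimeField p p-prime
  open CommutativeRing commutativeRing hiding (zero)
  open QuadraticExtension commutativeRing d public
  open import Algebra.Properties.Ring ring using (x∙y⁻¹≈ε⇒x≈y; -1*x≈-x)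
  open import Algebra.Properties.Semiring.Exp semiring using (_^_)

  d≉0 : d ≉ 0#
  d≉0 d≈0 = d-nonsquare (0 , 0<p , sym d≈0)

  norm≈0⇒≈0 : ∀ u → norm u ≈ 0# → u ≈² ι 0#
  norm≈0⇒≈0 (a , b) N≈0 with b ≈? 0#
  ... | yes b≈0 = a≈0 , b≈0
    where
    a≈0 : a ≈ 0#
    a≈0 with *-integral (begin
      a * a              ≈⟨ x∙y⁻¹≈ε⇒x≈y _ _ N≈0 ⟩
      d * (b * b)        ≈⟨ *-congˡ (*-congʳ b≈0) ⟩
      d * (0# * b)       ≈⟨ *-congˡ (zeroˡ b) ⟩
      d * 0#             ≈⟨ zeroʳ d ⟩
      0#                 ∎)
      where open import Relation.Binary.Reasoning.Setoid setoid
    ... | inj₁ a≈0 = a≈0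
    ... | inj₂ a≈0 = a≈0
  ... | no b≉0 = contradiction (a ÷ b , ÷<p a b , trans (≡⇒≈ (≡.sym (⊗≡* (a ÷ b) (a ÷ b)))) [a÷b]²≈d) d-nonsquare
    where
    b*b≉0 : b * b ≉ 0#
    b*b≉0 b*b≈0 = [ b≉0 , b≉0 ]′ (*-integral b*b≈0)
    [a÷b]²≈d : (a ÷ b) * (a ÷ b) ≈ d
    [a÷b]²≈d = *-cancelʳ-≉0 b*b≉0 (begin
      (a ÷ b) * (a ÷ b) * (b * b)      ≈⟨ solve 2 (λ x b → x :* x :* (b :* b) := (b :* x) :* (b :* x))
                                              refl (a ÷ b) b ⟩
      (b * (a ÷ b)) * (b * (a ÷ b))    ≈⟨ *-cong (*-÷ a b≉0) (*-÷ a b≉0) ⟩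
      a * a                            ≈⟨ x∙y⁻¹≈ε⇒x≈y _ _ N≈0 ⟩
      d * (b * b)                      ∎)
      where
      open import Algebra.Solver.Ring.NaturalCoefficients.Default commutativeSemiring
      open import Relation.Binary.Reasoning.Setoid setoid

  q*u≈u⇒q≈1 : ∀ {q u} → ¬ (u ≈² ι 0#) → q *² u ≈² u → q ≈² ι 1#
  q*u≈u⇒q≈1 {q} {u} u≉0 qu≈u =
    *-cancelʳ-≉0 N≉0 (trans (*-comm (proj₁ q) N) (trans (proj₁ Nq≈N) (sym (*-identityˡ N)))) ,
    *-cancelʳ-≉0 N≉0 (trans (*-comm (proj₂ q) N) (trans (proj₂ Nq≈N) (sym (zeroˡ N))))
    where
    N = norm u
    N≉0 : N ≉ 0#
    N≉0 = u≉0 ∘ norm≈0⇒≈0 u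
    Nq≈N : (N * proj₁ q , N * proj₂ q) ≈² ι N
    Nq≈N = E.trans (E.sym (ι-*ˡ N q)) (E.trans (E.*-comm (ι N) q) (E.trans (*²-cong E.refl (E.sym (*-conj u)))
             (E.trans (E.sym (E.*-assoc q u (conj u))) (E.trans (*²-cong qu≈u E.refl) (*-conj u)))))

  p·²1≈0 : p ·² E.1# ≈² E.0#
  p·²1≈0 = E.trans (ι-·1 p) (p·1≈0 , refl)

  module _ {e} (p≡1+2e : p ≡ suc (2 ℕ.* e)) where
    open import Algebra.Properties.Semiring.Exp E.semiring using (^-congˡ; ^-assocʳ)
    open import Algebra.Properties.CommutativeSemiring.Exp E.commutativeSemiring using (^-distrib-*)

    √d^p≈-√d : √d ^² p ≈² ι (- 1#) *² √d
    √d^p≈-√d = begin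
      √d ^² p                         ≡⟨ cong (√d ^²_) p≡1+2e ⟩
      √d *² √d ^² (2 ℕ.* e)           ≈⟨ *²-cong E.refl (^-assocʳ √d 2 e) ⟨
      √d *² (√d ^² 2) ^² e            ≈⟨ *²-cong E.refl (^-congˡ e √d²≈d) ⟩
      √d *² ι d ^² e                  ≈⟨ *²-cong E.refl (ι-^ d e) ⟩
      √d *² ι (d ^ e)                 ≈⟨ *²-cong E.refl (euler {e} p≡1+2e d≉0 d-nonsquare , refl) ⟩
      √d *² ι (- 1#)                  ≈⟨ E.*-comm √d (ι (- 1#)) ⟩
      ι (- 1#) *² √d                  ∎
      where
      open import Relation.Binary.Reasoning.Setoid E.setoid
      √d²≈d = E.trans (*²-cong E.refl (E.*-identityʳ √d)) √d*√d

    frobenius : ∀ u → u ^² p ≈² conj u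
    frobenius (a , b) = begin
      (a , b) ^² p
        ≈⟨ ^-congˡ p (decompose a b) ⟨
      (ι a +² ι b *² √d) ^² p
        ≈⟨ [x+y]^p≈x^p+y^p E.commutativeSemiring p-prime p·²1≈0 (ι a) (ι b *² √d) ⟩
      ι a ^² p +² (ι b *² √d) ^² p
        ≈⟨ E.+-cong (ι-^ a p) (^-distrib-* (ι b) √d p) ⟩
      ι (a ^ p) +² ι b ^² p *² √d ^² p
        ≈⟨ E.+-cong (fermat a , refl) (*²-cong (E.trans (ι-^ b p) (fermat b , refl)) √d^p≈-√d) ⟩
      ι a +² ι b *² (ι (- 1#) *² √d)
        ≈⟨ E.+-congˡ (E.*-assoc (ι b) (ι (- 1#)) √d) ⟨
      ι a +² ι b *² ι (- 1#) *² √d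
        ≈⟨ E.+-congˡ (*²-cong (E.trans (ι-* b (- 1#)) (b*-1≈-b , refl)) E.refl) ⟩
      ι a +² ι (- b) *² √d
        ≈⟨ decompose a (- b) ⟩
      conj (a , b) ∎
      where
      open import Relation.Binary.Reasoning.Setoid E.setoid
      b*-1≈-b : b * - 1# ≈ - b
      b*-1≈-b = trans (*-comm b (- 1#)) (-1*x≈-x b)

-- The eigenvalue of an elliptic rotation

module EllipticCoordinate (p : ℕ) (p-prime : Prime p) {j} (p+1≡2^[1+j] : p ℕ.+ 1 ≡ 2 ℕ.^ suc j) (c : ℕ)
  (c-elliptic : Elliptic p {{prime⇒nonZero p-prime}} c)
  (c-legendre : LegendreMinusOne p {{prime⇒nonZero p-prime}} (3 ℕ.* c ℕ.+ 2)) where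
  private instance p≢0 = prime⇒nonZero p-prime
  open PrimeField p p-prime
  open CommutativeRing commutativeRing hiding (zero)
  open import Algebra.Properties.Ring ring using (x[y-z]≈xy-xz; -0#≈0#; -‿distribʳ-*; -‿involutive; +-cancelʳ)
  open import Algebra.Solver.Ring.NaturalCoefficients.Default commutativeSemiring
  open import Data.Nat.DivMod using (_%_; [m+kn]%n≡m%n)
  import Algebra.Properties.CommutativeSemigroup

  D : ℕ
  D = subP p (9 ℕ.* c ℕ.* c) 4
  open NonsquareExtension p p-prime D c-elliptic

  e h : ℕ
  e = ℕ.pred (2 ℕ.^ j)
  h = suc e

  h≡2^j : h ≡ 2 ℕ.^ j
  h≡2^j = ℕₚ.suc-pred (2 ℕ.^ j) {{ℕₚ.m^n≢0 2 j}}

  p≡1+2e : p ≡ suc (2 ℕ.* e)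
  p≡1+2e = ℕₚ.suc-injective (begin
    suc p              ≡⟨ ℕₚ.+-comm 1 p ⟩
    p ℕ.+ 1            ≡⟨ p+1≡2^[1+j] ⟩
    2 ℕ.* 2 ℕ.^ j      ≡⟨ cong (2 ℕ.*_) h≡2^j ⟨
    2 ℕ.* suc e        ≡⟨ ℕₚ.*-suc 2 e ⟩
    suc (suc (2 ℕ.* e)) ∎)
    where open ≡.≡-Reasoning

  a two : ℕ
  a   = 3 * c
  two = 1# + 1#

  two*h≈1 : two * h ≈ 1#
  two*h≈1 = ≡.trans (cong (_% p) two*h≡1+p) ([m+kn]%n≡m%n 1 1 p)
    where
    open ≡.≡-Reasoning
    two*h≡1+p : two * h ≡ 1 ℕ.+ 1 ℕ.* p
    two*h≡1+p = begin
      two * h                ≡⟨ ≡.trans (⊗≡* two h) (cong (ℕ._* h) (⊕≡+ 1 1)) ⟩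
      2 ℕ.* suc e            ≡⟨ ℕₚ.*-suc 2 e ⟩
      suc (suc (2 ℕ.* e))    ≡⟨ cong suc p≡1+2e ⟨
      suc p                  ≡⟨ cong suc (ℕₚ.+-identityʳ p) ⟨
      1 ℕ.+ 1 ℕ.* p          ∎

  D+4≈a*a : D + two * two ≈ a * a
  D+4≈a*a = begin
    D + two * two
      ≈⟨ +-cong (subP≈ (9 ℕ.* c ℕ.* c) 4) (≡⇒≈ (≡.trans (⊗≡* two two) (cong₂ ℕ._*_ (⊕≡+ 1 1) (⊕≡+ 1 1)))) ⟩
    9 ℕ.* c ℕ.* c - 4 + 4
      ≈⟨ +-assoc _ (- 4) 4 ⟩
    9 ℕ.* c ℕ.* c + (- 4 + 4)
      ≈⟨ +-congˡ (-‿inverseˡ 4) ⟩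
    9 ℕ.* c ℕ.* c + 0#
      ≈⟨ +-identityʳ _ ⟩
    9 ℕ.* c ℕ.* c
      ≡⟨ ≡.trans (ℕₚ.*-assoc 9 c c) (ℕI.interchange 3 3 c c) ⟩
    3 ℕ.* c ℕ.* (3 ℕ.* c)
      ≡⟨ ≡.sym (≡.trans (⊗≡* a a) (cong₂ ℕ._*_ (⊗≡* 3 c) (⊗≡* 3 c))) ⟩
    a * a ∎
    where
    open import Relation.Binary.Reasoning.Setoid setoid
    module ℕI = Algebra.Properties.CommutativeSemigroup ℕₚ.*-commutativeSemigroup

  a+two≈3c+2 : a + two ≈ 3 ℕ.* c ℕ.+ 2
  a+two≈3c+2 = ≡⇒≈ (≡.trans (⊕≡+ a two) (cong₂ ℕ._+_ (⊗≡* 3 c) (⊕≡+ 1 1)))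

  -- t = (a + √D)/2, as h is the inverse of 2.
  t t̄ : Carrier²
  t = (h * a , h)
  t̄ = conj t

  norm-t≈1 : norm t ≈ 1#
  norm-t≈1 = begin
    h * a * (h * a) - D * (h * h)
      ≈⟨ +-cong (solve 2 (λ h a → h :* a :* (h :* a) := h :* h :* (a :* a)) refl h a) (-‿cong (*-comm D (h * h))) ⟩
    h * h * (a * a) - h * h * D
      ≈⟨ x[y-z]≈xy-xz (h * h) (a * a) D ⟨
    h * h * (a * a - D)
      ≈⟨ *-congˡ a*a-D≈4 ⟩
    h * h * (two * two)
      ≈⟨ solve 2 (λ h w → h :* h :* (w :* w) := (w :* h) :* (w :* h)) refl h two ⟩
    (two * h) * (two * h)
      ≈⟨ *-cong two*h≈1 two*h≈1 ⟩
    1# * 1#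
      ≈⟨ *-identityˡ 1# ⟩
    1# ∎
    where
    open import Relation.Binary.Reasoning.Setoid setoid
    a*a-D≈4 : a * a - D ≈ two * two
    a*a-D≈4 = begin
      a * a - D                  ≈⟨ +-congʳ D+4≈a*a ⟨
      D + two * two - D          ≈⟨ solve 3 (λ D x N → D :+ x :+ N := x :+ (D :+ N)) refl D (two * two) (- D) ⟩
      two * two + (D - D)        ≈⟨ +-congˡ (-‿inverseʳ D) ⟩
      two * two + 0#             ≈⟨ +-identityʳ _ ⟩
      two * two                  ∎

  t*t̄≈1 : t *² t̄ ≈² ι 1#
  t*t̄≈1 = E.trans (*-conj t) (norm-t≈1 , refl)

  t+t̄≈a : t +² t̄ ≈² ι a
  t+t̄≈a = trans (solve 2 (λ h a → h :* a :+ h :* a := (con 1 :+ con 1) :* h :* a) refl h a)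
                (trans (*-congʳ two*h≈1) (*-identityˡ a)) ,
          -‿inverseʳ h

  -1≉1 : ¬ (E.- E.1# ≈² E.1#)
  -1≉1 (-1≈1 , _) = 1≉0 (begin
    1#                 ≈⟨ two*h≈1 ⟨
    (1# + 1#) * h      ≈⟨ *-congʳ (+-congˡ -1≈1) ⟨
    (1# - 1#) * h      ≈⟨ *-congʳ (-‿inverseʳ 1#) ⟩
    0# * h             ≈⟨ zeroˡ h ⟩
    0#                 ∎)
    where open import Relation.Binary.Reasoning.Setoid setoid

  t^2^j≈-1 : t ^² (2 ℕ.^ j) ≈² E.- E.1#
  t^2^j≈-1 = subst (λ n → t ^² n ≈² E.- E.1#) h≡2^j
    (ConjugateRoots.t^[1+e]≈-1 commutativeRing² t*t̄≈1 t+t̄≈a {p} {e}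
      p-prime p·²1≈0 p≡1+2e (frobenius {e} p≡1+2e t) γ^e≈-1)
    where
    γ≉0 : a + two ≉ 0#
    γ≉0 γ≈0 = proj₁ c-legendre (≡.trans (≡.sym a+two≈3c+2) (≡.trans γ≈0 0%p≡0))
    γ-nonsquare : ¬ IsSquareModP p (a + two)
    γ-nonsquare (y , y<p , y*y≈γ) = proj₂ c-legendre (y , y<p , ≡.trans y*y≈γ a+two≈3c+2)
    γ^e≈-1 : (ι a +² (E.1# +² E.1#)) ^² e ≈² E.- E.1#
    γ^e≈-1 = E.trans (E.trans (^²-congˡ e (refl , trans (+-identityˡ _) (+-identityˡ 0#))) (ι-^ (a + two) e))
                     (euler {e} p≡1+2e γ≉0 γ-nonsquare , sym -0#≈0#)
      where open import Algebra.Properties.Semiring.Exp E.semiring using () renaming (^-congˡ to ^²-congˡ)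

  eigen : ℕ × ℕ → Carrier²
  eigen (y , z) = ι z E.- ι y *² t̄

  eigen-components : ∀ y z → eigen (y , z) ≈² (z - y * (h * a) , y * h)
  eigen-components y z = E.trans (E.+-congˡ (E.-‿cong (ι-*ˡ y t̄))) (refl ,
    trans (+-identityˡ _) (trans (-‿cong (sym (-‿distribʳ-* y h))) (-‿involutive (y * h))))

  h≉0 : h ≉ 0#
  h≉0 h≈0 = 1≉0 (trans (sym two*h≈1) (trans (*-congˡ h≈0) (zeroʳ two)))

  eigen-0 : eigen (0 , 0) ≈² E.0#
  eigen-0 = E.trans (eigen-components 0 0) (trans (+-congˡ (trans (-‿cong (zeroˡ _)) -0#≈0#)) (+-identityʳ 0#) , zeroˡ h)

  eigen-injective : ∀ {y z y′ z′} → eigen (y , z) ≈² eigen (y′ , z′) → y ≈ y′ × z ≈ z′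
  eigen-injective {y} {z} {y′} {z′} eq = y≈y′ ,
      +-cancelʳ (- (y * (h * a))) z z′ (trans z-yha≈z′-y′ha (+-congˡ (-‿cong (*-congʳ (sym y≈y′)))))
    where
    eq′ = E.trans (E.sym (eigen-components y z)) (E.trans eq (eigen-components y′ z′))
    y≈y′ = *-cancelʳ-≉0 h≉0 (proj₂ eq′)
    z-yha≈z′-y′ha = proj₁ eq′

  eigen-step : ∀ {y z w} → w ≈ a * z - y → eigen (z , w) ≈² t *² eigen (y , z)
  eigen-step {y} {z} {w} w≈az-y = E.sym (E.trans
    (ConjugateRoots.t[z-yt̄]≈[az-y]-zt̄ commutativeRing² t*t̄≈1 t+t̄≈a (ι y) (ι z))
    (E.+-congʳ (E.trans (E.+-congʳ (ι-* a z)) (sym w≈az-y , trans (+-identityˡ _) -0#≈0#))))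

  Reduced : ℕ × ℕ → Set
  Reduced (y , z) = y ℕ.< p × z ℕ.< p

  module Orbit (g : ℕ × ℕ → ℕ × ℕ)
    (g-step : ∀ y z → proj₁ (g (y , z)) ≡ z × proj₂ (g (y , z)) ℕ.< p × proj₂ (g (y , z)) ≈ a * z - y) where

    eigen-fold : ∀ v n → eigen (fold v g n) ≈² t ^² n *² eigen v
    eigen-fold v zero    = E.sym (E.*-identityˡ (eigen v))
    eigen-fold v (suc n) with fold v g n | eigen-fold v n
    ... | (y , z) | IH with g (y , z) | g-step y z
    ...   | (z′ , w) | ≡.refl , _ , w≈az-y =
      E.trans (eigen-step w≈az-y) (E.trans (*²-cong E.refl IH) (E.sym (E.*-assoc t (t ^² n) (eigen v))))

    fold-reduced : ∀ {v} n → Reduced v → Reduced (fold v g n)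
    fold-reduced zero    rv = rv
    fold-reduced {v} (suc n) rv with fold v g n | fold-reduced n rv
    ... | (y , z) | _ , z<p with g (y , z) | g-step y z
    ...   | (z′ , w) | ≡.refl , w<p , _ = z<p , w<p

    fold≡⇒^≈1 : ∀ {v} n → Reduced v → v ≢ (0 , 0) → fold v g n ≡ v → t ^² n ≈² E.1#
    fold≡⇒^≈1 {v} n rv v≢0 gⁿv≡v = q*u≈u⇒q≈1 eigen-v≉0
      (E.trans (E.sym (eigen-fold v n)) (E.reflexive (cong eigen gⁿv≡v)))
      where
      eigen-v≉0 : ¬ (eigen v ≈² E.0#)
      eigen-v≉0 eigen-v≈0 with eigen-injective (E.trans eigen-v≈0 (E.sym eigen-0))
      ... | y≈0 , z≈0 = v≢0 (cong₂ _,_ (≈⇒≡ (proj₁ rv) 0<p y≈0) (≈⇒≡ (proj₂ rv) 0<p z≈0))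

    ^≈1⇒fold≡ : ∀ {v} n → Reduced v → t ^² n ≈² E.1# → fold v g n ≡ v
    ^≈1⇒fold≡ {v} n rv tⁿ≈1
      with eigen-injective (E.trans (eigen-fold v n) (E.trans (*²-cong tⁿ≈1 E.refl) (E.*-identityˡ (eigen v))))
    ... | y≈ , z≈ = cong₂ _,_ (≈⇒≡ (proj₁ ru) (proj₁ rv) y≈) (≈⇒≡ (proj₂ ru) (proj₂ rv) z≈)
      where ru = fold-reduced n rv

    fold-order : ∀ {v} → Reduced v → v ≢ (0 , 0) →
                 fold v g (p ℕ.+ 1) ≡ v × (∀ m → 0 ℕ.< m → m ℕ.< p ℕ.+ 1 → fold v g m ≢ v)
    fold-order rv v≢0 =
      ^≈1⇒fold≡ (p ℕ.+ 1) rv (subst (λ n → t ^² n ≈² E.1#) (≡.sym p+1≡2^[1+j]) t^2^[1+j]≈1) ,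
      λ m 0<m m<p+1 gᵐv≡v →
        ^2^j≈-1⇒^m≉1 commutativeRing² -1≉1 j t^2^j≈-1 0<m (subst (m ℕ.<_) p+1≡2^[1+j] m<p+1)
          (fold≡⇒^≈1 m rv v≢0 gᵐv≡v)
      where t^2^[1+j]≈1 = ^2^j≈-1⇒^2^[1+j]≈1 commutativeRing² j t^2^j≈-1

insert : Fin 3 → ℕ → ℕ × ℕ → Triple
insert Fin.zero             c (y , z) = (c , y , z)
insert (Fin.suc Fin.zero)   c (y , z) = (y , c , z)
insert (Fin.suc (Fin.suc Fin.zero)) c (y , z) = (y , z , c)

others : Fin 3 → Triple → ℕ × ℕ
others Fin.zero             (_ , y , z) = (y , z)
others (Fin.suc Fin.zero)   (y , _ , z) = (y , z)
others (Fin.suc (Fin.suc Fin.zero)) (y , z , _) = (y , z)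

insert-others : ∀ i x → insert i (coord i x) (others i x) ≡ x
insert-others Fin.zero                     x = ≡.refl
insert-others (Fin.suc Fin.zero)           x = ≡.refl
insert-others (Fin.suc (Fin.suc Fin.zero)) x = ≡.refl

others-insert : ∀ i c v → others i (insert i c v) ≡ v
others-insert Fin.zero                     c v = ≡.refl
others-insert (Fin.suc Fin.zero)           c v = ≡.refl
others-insert (Fin.suc (Fin.suc Fin.zero)) c v = ≡.refl

insert-injective : ∀ i c {u v} → insert i c u ≡ insert i c v → u ≡ v
insert-injective i c {u} {v} eq = ≡.trans (≡.sym (others-insert i c u)) (≡.trans (cong (others i) eq) (others-insert i c v))

module MarkoffRotation (p : ℕ) .{{_ : NonZero p}} where
  open ResidueRing p using (commutativeRing; ≡⇒≈; ⊗≡*; subP≈)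
  open CommutativeRing commutativeRing using (_≈_; _*_; _-_; trans)
  open import Data.Nat.DivMod using (m%n<n)

  rotation : Fin 3 → ℕ → ℕ × ℕ → ℕ × ℕ
  rotation i c v = others i (rot p i (insert i c v))

  private
    subP≈3cz-y : ∀ c y z {m} → m ≡ 3 ℕ.* c ℕ.* z → subP p m y ≈ 3 * c * z - y
    subP≈3cz-y c y z {m} m≡3cz = trans (subP≈ m y) (≡⇒≈ (cong (_- y) (≡.trans m≡3cz
      (≡.sym (≡.trans (⊗≡* (3 * c) z) (cong (ℕ._* z) (⊗≡* 3 c)))))))

  rot-insert : ∀ i c v → rot p i (insert i c v) ≡ insert i c (rotation i c v)
  rot-insert Fin.zero                     c v = ≡.refl
  rot-insert (Fin.suc Fin.zero)           c v = ≡.refl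
  rot-insert (Fin.suc (Fin.suc Fin.zero)) c v = ≡.refl

  rotIter-insert : ∀ i c v n → rotIter p i n (insert i c v) ≡ insert i c (fold v (rotation i c) n)
  rotIter-insert i c v zero    = ≡.refl
  rotIter-insert i c v (suc n) = ≡.trans (cong (rot p i) (rotIter-insert i c v n)) (rot-insert i c _)

  rotation-step : ∀ i c y z → proj₁ (rotation i c (y , z)) ≡ z × proj₂ (rotation i c (y , z)) ℕ.< p ×
                              proj₂ (rotation i c (y , z)) ≈ 3 * c * z - y
  rotation-step Fin.zero                     c y z = ≡.refl , m%n<n _ p , subP≈3cz-y c y z ≡.refl
  rotation-step (Fin.suc Fin.zero)           c y z = ≡.refl , m%n<n _ p , subP≈3cz-y c y z ≡.refl
  rotation-step (Fin.suc (Fin.suc Fin.zero)) c y z = ≡.refl , m%n<n _ p , subP≈3cz-y c y z 3zc≡3cz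
    where
    3zc≡3cz : 3 ℕ.* z ℕ.* c ≡ 3 ℕ.* c ℕ.* z
    3zc≡3cz = ≡.trans (ℕₚ.*-assoc 3 z c) (≡.trans (cong (3 ℕ.*_) (ℕₚ.*-comm z c)) (≡.sym (ℕₚ.*-assoc 3 c z)))

module _ (p : ℕ) (p-prime : Prime p) where
  private instance p≢0 = prime⇒nonZero p-prime
  open MarkoffRotation p
  open PrimeField p p-prime using (≈⇒≡; ≈0⇒∣; ∣⇒≈0; 0<p)
  open import Data.Nat using (_+_; _*_; _<_)
  open import Data.Nat.DivMod using (_%_)

  private
    square≈0⇒≡0 : ∀ {c} → c < p → (c * c) % p ≡ 0 % p → c ≡ 0
    square≈0⇒≡0 {c} c<p c²≈0 = [ p∣c⇒c≡0 , p∣c⇒c≡0 ]′ (euclidsLemma c c p-prime (≈0⇒∣ c²≈0))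
      where p∣c⇒c≡0 = λ p∣c → ≈⇒≡ c<p 0<p (∣⇒≈0 p∣c)

  others≢0 : ∀ i {x} → InXstar p x → others i x ≢ (0 , 0)
  others≢0 Fin.zero {x₁ , _ , _} ((x₁<p , _) , x≢0 , markoff) ≡.refl =
    x≢0 (cong (_, 0 , 0) (square≈0⇒≡0 x₁<p (≡.trans (cong (_% p) (≡.sym (≡.trans (ℕₚ.+-identityʳ _) (ℕₚ.+-identityʳ _))))
                                                (≡.trans markoff (cong (_% p) (ℕₚ.*-zeroʳ (3 * x₁ * 0)))))))
  others≢0 (Fin.suc Fin.zero) {_ , x₂ , _} ((_ , x₂<p , _) , x≢0 , markoff) ≡.refl =
    x≢0 (cong (λ c → 0 , c , 0) (square≈0⇒≡0 x₂<p (≡.trans (cong (_% p) (≡.sym (ℕₚ.+-identityʳ _))) markoff)))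
  others≢0 (Fin.suc (Fin.suc Fin.zero)) {_ , _ , x₃} ((_ , _ , x₃<p) , x≢0 , markoff) ≡.refl =
    x≢0 (cong (λ c → 0 , 0 , c) (square≈0⇒≡0 x₃<p markoff))

  others-reduced : ∀ i {x} → InFp3 p x → proj₁ (others i x) < p × proj₂ (others i x) < p
  others-reduced Fin.zero                     (_ , x₂<p , x₃<p) = x₂<p , x₃<p
  others-reduced (Fin.suc Fin.zero)           (x₁<p , _ , x₃<p) = x₁<p , x₃<p
  others-reduced (Fin.suc (Fin.suc Fin.zero)) (x₁<p , x₂<p , _) = x₁<p , x₂<p

  rotation-order : ∀ {j} → p + 1 ≡ 2 ℕ.^ suc j → ∀ i {x} → InXstar p x →
                   Elliptic p (coord i x) → LegendreMinusOne p (3 * coord i x + 2) → IsOrd p i x (p + 1)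
  rotation-order {j} p+1≡2^[1+j] i {x} x∈X* c-elliptic c-legendre =
    ℕₚ.m≤n+m 1 p ,
    fold≡⇒rotIter≡ (p + 1) (proj₁ order) ,
    λ m 0<m m<p+1 → proj₂ order m 0<m m<p+1 ∘ rotIter≡⇒fold≡ m
    where
    c = coord i x
    v = others i x
    open EllipticCoordinate p p-prime {j} p+1≡2^[1+j] c c-elliptic c-legendre
    open Orbit (rotation i c) (rotation-step i c)
    order = fold-order (others-reduced i (proj₁ x∈X*)) (others≢0 i x∈X*)
    rotIter≡insert-fold : ∀ n → rotIter p i n x ≡ insert i c (fold v (rotation i c) n)
    rotIter≡insert-fold n = ≡.trans (cong (rotIter p i n) (≡.sym (insert-others i x))) (rotIter-insert i c v n)
    fold≡⇒rotIter≡ : ∀ n → fold v (rotation i c) n ≡ v → rotIter p i n x ≡ x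
    fold≡⇒rotIter≡ n gⁿv≡v = ≡.trans (rotIter≡insert-fold n) (≡.trans (cong (insert i c) gⁿv≡v) (insert-others i x))
    rotIter≡⇒fold≡ : ∀ n → rotIter p i n x ≡ x → fold v (rotation i c) n ≡ v
    rotIter≡⇒fold≡ n rⁿx≡x =
      insert-injective i c (≡.trans (≡.sym (rotIter≡insert-fold n)) (≡.trans rⁿx≡x (≡.sym (insert-others i x))))

module _ where
  open import Data.Nat using (_+_; _*_; _^_; _<_; _≤_; _≡ᵇ_)
  open import Data.Nat.DivMod using (_%_; _/_; m≡m%n+[m/n]*n)
  open import Data.Nat.Divisibility using (1∣_; *-monoʳ-∣)
  open import Data.Bool using (T)

  2^ν₂-aux∣ : ∀ f n → 2 ^ ν₂-aux f n ∣ n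
  2^ν₂-aux∣ zero    n         = 1∣ n
  2^ν₂-aux∣ (suc f) zero      = 1∣ 0
  2^ν₂-aux∣ (suc f) n@(suc _) with n % 2 ≡ᵇ 0 in n%2≡ᵇ0
  ... | false = 1∣ n
  ... | true  = subst (2 * 2 ^ ν₂-aux f (n / 2) ∣_) (≡.sym n≡2*[n/2]) (*-monoʳ-∣ 2 (2^ν₂-aux∣ f (n / 2)))
    where
    n≡2*[n/2] : n ≡ 2 * (n / 2)
    n≡2*[n/2] = ≡.trans (m≡m%n+[m/n]*n n 2)
      (≡.trans (cong (_+ n / 2 * 2) (ℕₚ.≡ᵇ⇒≡ (n % 2) 0 (subst T (≡.sym n%2≡ᵇ0) _))) (ℕₚ.*-comm (n / 2) 2))

  2^ν₂∣ : ∀ n → 2 ^ ν₂ n ∣ n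
  2^ν₂∣ n = 2^ν₂-aux∣ n n

  ∣∧<2*⇒≡ : ∀ {m n} → m ∣ n → 0 < n → n < 2 * m → n ≡ m
  ∣∧<2*⇒≡ (divides zero          n≡0)    0<n _     = contradiction n≡0 (ℕₚ.>⇒≢ 0<n)
  ∣∧<2*⇒≡ (divides (suc zero)    n≡m+0)  _   _     = ≡.trans n≡m+0 (ℕₚ.+-identityʳ _)
  ∣∧<2*⇒≡ {m} (divides (suc (suc q)) n≡[2+q]m) _ n<2m =
    contradiction (subst (2 * m ≤_) (≡.sym n≡[2+q]m) (ℕₚ.*-monoˡ-≤ m (ℕ.s≤s (ℕ.s≤s (ℕ.z≤n {q}))))) (ℕₚ.<⇒≱ n<2m)

  p+1≡2^k⇒p+1≡2^[1+j] : ∀ {p} → Prime p → ∀ k → p + 1 ≡ 2 ^ k → ∃[ j ] p + 1 ≡ 2 ^ suc j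
  p+1≡2^k⇒p+1≡2^[1+j] {p} p-prime zero p+1≡1 =
    contradiction (ℕₚ.+-cancelʳ-≡ 1 p 0 p+1≡1) (ℕ.≢-nonZero⁻¹ p {{prime⇒nonZero p-prime}})
  p+1≡2^k⇒p+1≡2^[1+j] p-prime (suc j) p+1≡2^[1+j] = j , p+1≡2^[1+j]

open import Data.Nat using (_+_; _*_; _^_; _<_)

corollary4p2 : (p : ℕ) (pp : Prime p) → 5 < p → (x : Triple) →
    InXstar p {{prime⇒nonZero pp}} x →
    (∃[ i ] (Elliptic p {{prime⇒nonZero pp}} (coord i x) ×
             LegendreMinusOne p {{prime⇒nonZero pp}} (3 * coord i x + 2))) →
    p + 1 < 2 * 2 ^ ν₂ (p + 1) →
    InCage p {{prime⇒nonZero pp}} x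
corollary4p2 p pp _ x x∈X* (i , c-elliptic , c-legendre) p+1<2*2^ν
  with p+1≡2^k⇒p+1≡2^[1+j] pp (ν₂ (p + 1)) (∣∧<2*⇒≡ (2^ν₂∣ (p + 1)) (ℕₚ.m≤n+m 1 p) p+1<2*2^ν)
... | j , p+1≡2^[1+j] =
  x∈X* , i , p + 1 , rotation-order p pp {j} p+1≡2^[1+j] i x∈X* c-elliptic c-legendre , inj₂ (inj₁ ≡.refl)
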